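{- For $n\ge1$, $|\mathcal{T}_n^{(1,n)}|=1$, and for $n\ge2$ and $1\le p\le n-1$, $$|\mathcal{T}_n^{(1,p)}|=\sum_{r=1}^{n}|\mathcal{T}_{n-1}^{(r,p)}|.$$
   Context: For $\pi\in S_n$, $r\in[n+1]$, $1\le p\le n$, the configuration $\pi^{(r,p)}$ on sites $\{0,\dots,n+1\}$ places on site $i$ ($1\le i\le n$) the chip $\pi_i$ if $\pi_i<r$ and $\pi_i+1$ otherwise, plus an extra chip $r$ on site $p$. Toppling: while a site $i$ has at least two chips, pick two chips $\alpha<\beta$ there and move $\alpha$ to $i-1$, $\beta$ to $i+1$; the final configuration is independent of choices, with one chip per site but one. $\mathcal{T}_n^{(r,p)}$ is the set of $\pi\in S_n$ for which the chips of the final configuration from $\pi^{(r,p)}$, read left to right, are $1,2,\dots,n+1$. -}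

module Defs where

open import Data.Nat using (ℕ; zero; suc; _+_; _∸_; _≤_; _<_; _<ᵇ_; _≡ᵇ_)
open import Data.Integer as ℤ using (ℤ; +_; -[1+_])
open import Data.Integer.Properties as ℤP using ()
open import Data.List using (List; []; _∷_; map; concat; length; upTo)
open import Data.List.Relation.Unary.Unique.Propositional using (Unique)
open import Data.List.Membership.Propositional using (_∈_)
open import Data.List.Relation.Binary.Permutation.Propositional using (_↭_)
import Data.Nat.ListAction
open import Data.Bool using (Bool; true; false; if_then_else_)
open import Data.Product using (Σ; ∃; _×_; _,_)
open import Function.Bundles using (_⇔_)
open import Relation.Binary.PropositionalEquality using (_≡_)
open import Relation.Binary.Construct.Closure.ReflexiveTransitive using (Star)
open import Relation.Nullary using (does)

range : ℕ → ℕ → List ℕ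
range a b = map (λ k → a + k) (upTo (suc b ∸ a))

-- π ∈ S_n, represented as its one-line notation π₁ … πₙ (a list of 1..n)
IsPerm : ℕ → List ℕ → Set
IsPerm n π = π ↭ range 1 n

-- a chip configuration: site i ∈ ℤ holds the (multi)set of chips c i
Config : Set
Config = ℤ → List ℕ

-- i-th entry (1-based) of a list, or nothing
at : List ℕ → ℕ → List ℕ
at []       _             = []
at (x ∷ xs) zero          = []
at (x ∷ xs) (suc zero)    = x ∷ []
at (x ∷ xs) (suc (suc i)) = at xs (suc i)

shift : ℕ → ℕ → ℕ
shift r x = if x <ᵇ r then x else suc x

initConfig : List ℕ → ℕ → ℕ → Config
initConfig π r p (+ i)    = (if i ≡ᵇ p then r ∷ [] else []) Data.List.++ map (shift r) (at π i)
initConfig π r p -[1+ _ ] = []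

topple : Config → ℤ → ℕ → ℕ → List ℕ → Config
topple c i α β rest j =
  if does (j ℤ.≟ i) then rest
  else if does (j ℤ.≟ (i ℤ.- + 1)) then α ∷ c j
  else if does (j ℤ.≟ (i ℤ.+ + 1)) then β ∷ c j
  else c j

data Step (c : Config) : Config → Set where
  step : ∀ i α β rest → α < β → c i ↭ (α ∷ β ∷ rest) → Step c (topple c i α β rest)

Stable : Config → Set
Stable c = ∀ i → length (c i) ≤ 1

readConfig : ℕ → Config → List ℕ
readConfig n c = concat (map (λ i → c (+ i)) (range 0 (suc n)))

T : ℕ → ℕ → ℕ → List ℕ → Set
T n r p π = IsPerm n π ×
  ∃ λ (c : Config) → Star Step (initConfig π r p) c × Stable c × readConfig n c ≡ range 1 (suc n)

HasCard : (List ℕ → Set) → ℕ → Set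
HasCard P k = Σ (List (List ℕ)) λ xs → Unique xs × length xs ≡ k × (∀ π → (π ∈ xs) ⇔ P π)

sumRange : (ℕ → ℕ) → ℕ → ℕ → ℕ
sumRange f a b = Data.Nat.ListAction.sum (map f (range a b))

-- Under toppling, the prefix counts Qₖ (chips on sites 0..k) of a configuration of N chips on
-- sites 0..N stay squeezed between k and k+1, with Q_N = N.  Hence an unstable site holds
-- exactly two chips and is preceded by a tight prefix, so unstable sites are never adjacent and
-- two firings commute; with a bounded potential that every firing increases, this gives a unique
-- stable configuration up to the order of chips within a site.
-- For r = 1 the extra chip 1 sits on site p together with a larger chip, and sites 1..p-1 hold one
-- chip larger than 1 each, so chip 1 sweeps to site 0, each firing pushing the larger chip one step
-- right.  Apart from chip 1, what remains is, shifted one site right and with labels raised by one,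
-- the configuration σ^{(r,p)} where r = π_p and σ ∈ S_{n-1} is π with π_p removed and
-- renormalised.  So π ↦ (π_p, σ) is a bijection from 𝒯_n^{(1,p)} onto ⋃ᵣ 𝒯_{n-1}^{(r,p)}.  For p = n
-- nothing remains to topple, and the final reading 1, π₁+1, …, πₙ+1 is sorted only for the identity.
module Submission where

open import Defs
open import Data.Nat using (ℕ; zero; suc; _+_; _∸_; _≤_; _<_; z≤n; s≤s; _≡ᵇ_; _<ᵇ_; _*_)
open import Data.Nat.Properties
open import Data.Integer as ℤ using (ℤ; +_; -[1+_])
open import Data.List using (List; []; _∷_; [_]; _∷ʳ_; map; concat; length; upTo; applyUpTo; _++_; filter; cartesianProductWith; _∷ʳ′_; initLast)
import Data.List.Properties as LP
open import Data.List.Relation.Binary.Permutation.Propositional using (_↭_; ↭-refl; ↭-sym; ↭-trans; ↭-prep; ↭-swap; ↭-reflexive)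
import Data.List.Relation.Binary.Permutation.Propositional as Perm
import Data.List.Relation.Binary.Permutation.Propositional.Properties as PP
import Data.List.Relation.Binary.Permutation.Setoid.Properties as PermSetoid
open import Data.List.Relation.Unary.Unique.Propositional using (Unique)
import Data.List.Relation.Unary.Unique.Propositional.Properties as UP
open import Data.List.Relation.Unary.AllPairs using ([]; _∷_)
import Data.List.Relation.Unary.AllPairs as AP
import Data.List.Relation.Unary.AllPairs.Properties as APP
open import Data.List.Relation.Unary.All as All using (All; []; _∷_)
import Data.List.Relation.Unary.All.Properties as AllP
open import Data.List.Membership.Propositional using (_∈_)
open import Data.List.Relation.Binary.Disjoint.Propositional using (Disjoint)
import Data.List.Membership.Propositional.Properties as LMP
open import Data.List.Relation.Unary.Any using (here; there)
import Data.List.Sort as Sort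
open Sort ≤-decTotalOrder using (sort; sort-↭; sort-↗)
open import Data.List.Relation.Unary.Sorted.TotalOrder.Properties using (↗↭↗⇒≋)
open import Data.List.Relation.Binary.Pointwise using (Pointwise-≡⇒≡)
open import Data.Bool using (Bool; true; false; if_then_else_)
import Data.Bool as B
open import Data.Unit using (tt)
open import Data.Product using (Σ; _×_; _,_; proj₁; proj₂)
open import Data.Sum using (_⊎_; inj₁; inj₂; [_,_]′)
open import Data.Empty using (⊥-elim)
open import Relation.Nullary using (¬_; Dec; yes; no; does)
open import Relation.Nullary.Decidable as Dec using (map′)
open import Relation.Binary.PropositionalEquality hiding ([_])
open import Relation.Binary.Definitions using (tri<; tri≈; tri>)
open import Relation.Binary.Construct.Closure.ReflexiveTransitive using (Star; ε; _◅_; _◅◅_)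
open import Function.Base using (_∘_)
open import Function.Bundles using (_⇔_; mk⇔; Equivalence)
import Function.Properties.Equivalence as ⇔
import Data.Nat.ListAction
open import Data.Nat.Tactic.RingSolver using (solve-∀)

≡ᵇ-true⇒≡ : ∀ m n → (m ≡ᵇ n) ≡ true → m ≡ n
≡ᵇ-true⇒≡ m n e = ≡ᵇ⇒≡ m n (subst B.T (sym e) tt)

≡ᵇ-refl : ∀ n → (n ≡ᵇ n) ≡ true
≡ᵇ-refl zero = refl
≡ᵇ-refl (suc n) = ≡ᵇ-refl n

≢⇒≡ᵇ-false : ∀ m n → m ≢ n → (m ≡ᵇ n) ≡ false
≢⇒≡ᵇ-false m n m≢n with m ≡ᵇ n in e
... | true = ⊥-elim (m≢n (≡ᵇ-true⇒≡ m n e))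
... | false = refl

n≢1+n : ∀ n → n ≢ suc n
n≢1+n n = ≢-sym 1+n≢n

n≢2+n : ∀ n → n ≢ suc (suc n)
n≢2+n n = ≢-sym (m+1+n≢n 1)

-- At a non-negative site, topple reduces to this case analysis on the tests
-- "fired site", "left neighbour", "right neighbour".
toppledSite : Bool → Bool → Bool → List ℕ → List ℕ → List ℕ → List ℕ → List ℕ
toppledSite fired left right rest x y z = if fired then rest else if left then x else if right then y else z

toppledSite-cong : ∀ fired left right rest α β {x y} → x ↭ y →
  toppledSite fired left right rest (α ∷ x) (β ∷ x) x ↭ toppledSite fired left right rest (α ∷ y) (β ∷ y) y
toppledSite-cong true left right rest α β p = ↭-refl
toppledSite-cong false true right rest α β p = ↭-prep α p
toppledSite-cong false false true rest α β p = ↭-prep β p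
toppledSite-cong false false false rest α β p = p

_≈_ : Config → Config → Set
c ≈ d = ∀ j → c j ↭ d j

≈-refl : ∀ {c} → c ≈ c
≈-refl j = ↭-refl

≈-sym : ∀ {c d} → c ≈ d → d ≈ c
≈-sym e j = ↭-sym (e j)

≈-trans : ∀ {c d f} → c ≈ d → d ≈ f → c ≈ f
≈-trans e e' j = ↭-trans (e j) (e' j)

topple-cong : ∀ {c d} → c ≈ d → ∀ i α β rest → topple c i α β rest ≈ topple d i α β rest
topple-cong e i α β rest j =
  toppledSite-cong (does (j ℤ.≟ i)) (does (j ℤ.≟ (i ℤ.- + 1))) (does (j ℤ.≟ (i ℤ.+ + 1))) rest α β (e j)

Step-resp-≈ : ∀ {c d c'} → c ≈ d → Step c c' → Σ Config λ d' → Step d d' × c' ≈ d'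
Step-resp-≈ {d = d} e (step i α β rest lt p) =
  topple d i α β rest , step i α β rest lt (↭-trans (↭-sym (e i)) p) , topple-cong e i α β rest

Star-resp-≈ : ∀ {c d c'} → c ≈ d → Star Step c c' → Σ Config λ d' → Star Step d d' × c' ≈ d'
Star-resp-≈ e ε = _ , ε , e
Star-resp-≈ e (s ◅ ss) with Step-resp-≈ e s
... | d₁ , s' , e₁ with Star-resp-≈ e₁ ss
... | d₂ , ss' , e₂ = d₂ , s' ◅ ss' , e₂

Stable-resp-≈ : ∀ {s t} → s ≈ t → Stable s → Stable t
Stable-resp-≈ e st i = subst (_≤ 1) (PP.↭-length (e i)) (st i)

Unique-resp-↭ : ∀ {xs ys : List ℕ} → xs ↭ ys → Unique xs → Unique ys
Unique-resp-↭ p = PermSetoid.Unique-resp-↭ (setoid ℕ) (Perm.↭⇒↭ₛ p)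

module ToppleAt (c : Config) (u α β : ℕ) (rest : List ℕ) where
  private
    c' : Config
    c' = topple c (+ suc u) α β rest

  topple-left : c' (+ u) ≡ α ∷ c (+ u)
  topple-left rewrite ≢⇒≡ᵇ-false u (suc u) (n≢1+n u) | ≡ᵇ-refl u = refl

  topple-fired : c' (+ suc u) ≡ rest
  topple-fired rewrite ≡ᵇ-refl u = refl

  topple-right : c' (+ suc (suc u)) ≡ β ∷ c (+ suc (suc u))
  topple-right rewrite ≢⇒≡ᵇ-false (suc (suc u)) (suc u) (≢-sym (n≢1+n (suc u)))
                     | ≢⇒≡ᵇ-false (suc (suc u)) u (≢-sym (n≢2+n u))
                     | +-comm u 1 | ≡ᵇ-refl u = refl

  topple-far : ∀ k → k ≢ u → k ≢ suc u → k ≢ suc (suc u) → c' (+ k) ≡ c (+ k)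
  topple-far k k≢u k≢1+u k≢2+u
    rewrite ≢⇒≡ᵇ-false k (suc u) k≢1+u | ≢⇒≡ᵇ-false k u k≢u
          | ≢⇒≡ᵇ-false k (suc u + 1) (λ e → k≢2+u (trans e (cong suc (+-comm u 1)))) = refl

open ToppleAt

-- Prefix counts and the invariant

size : Config → ℕ → ℕ
size c k = length (c (+ k))

prefixSize : Config → ℕ → ℕ
prefixSize c zero = size c 0
prefixSize c (suc k) = prefixSize c k + size c (suc k)

site : Config → ℕ → List ℕ
site c k = c (+ k)

window : (ℕ → List ℕ) → ℕ → ℕ → List ℕ
window f k zero = []
window f k (suc n) = f k ++ window f (suc k) n

-- For π^{(r,p)} with π ∈ S_n one takes N = n + 1.
record Invariant (N : ℕ) (c : Config) : Set where
  field
    empty-left : ∀ k → length (c -[1+ k ]) ≡ 0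
    empty-right : ∀ k → N < k → size c k ≡ 0
    prefix-≥ : ∀ k → k < N → k ≤ prefixSize c k
    prefix-≤ : ∀ k → k < N → prefixSize c k ≤ suc k
    prefix-N : prefixSize c N ≡ N
    window-unique : Unique (window (site c) 0 (suc N))

window-ext : ∀ {f g} n k → (∀ i → k ≤ i → i < k + n → f i ≡ g i) → window f k n ≡ window g k n
window-ext zero k e = refl
window-ext (suc n) k e = cong₂ _++_ (e k ≤-refl (subst (k <_) (sym (+-suc k n)) (s≤s (m≤m+n k n))))
  (window-ext n (suc k) (λ i k<i i< → e i (<⇒≤ k<i) (subst (i <_) (sym (+-suc k n)) i<)))

window-split : ∀ f k a b → window f k (a + b) ≡ window f k a ++ window f (k + a) b
window-split f k zero b = cong (λ z → window f z b) (sym (+-identityʳ k))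
window-split f k (suc a) b = begin
    f k ++ window f (suc k) (a + b)
  ≡⟨ cong (f k ++_) (window-split f (suc k) a b) ⟩
    f k ++ (window f (suc k) a ++ window f (suc k + a) b)
  ≡⟨ sym (LP.++-assoc (f k) _ _) ⟩
    (f k ++ window f (suc k) a) ++ window f (suc k + a) b
  ≡⟨ cong (λ z → (f k ++ window f (suc k) a) ++ window f z b) (sym (+-suc k a)) ⟩
    (f k ++ window f (suc k) a) ++ window f (k + suc a) b ∎
  where open ≡-Reasoning

record Firing (N : ℕ) (c : Config) (i : ℤ) (rest : List ℕ) : Set where
  field
    u : ℕ
    i≡1+u : i ≡ + suc u
    1+u<N : suc u < N
    prefix-tight : prefixSize c u ≡ u
    two-chips : size c (suc u) ≡ 2
    rest≡[] : rest ≡ []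

length≡0⇒≡[] : ∀ {xs : List ℕ} → length xs ≡ 0 → xs ≡ []
length≡0⇒≡[] {[]} _ = refl

squeeze : ∀ q u l → u ≤ q → q + suc (suc l) ≤ suc (suc u) → q ≡ u × l ≡ 0
squeeze q u l u≤q h = q≡u , l≡0
  where
  q+l≤u : q + l ≤ u
  q+l≤u = ≤-pred (≤-pred (subst (_≤ suc (suc u)) (trans (+-suc q (suc l)) (cong suc (+-suc q l))) h))
  q≡u : q ≡ u
  q≡u = ≤-antisym (≤-trans (m≤m+n q l) q+l≤u) u≤q
  l≡0 : l ≡ 0
  l≡0 = n≤0⇒n≡0 (+-cancelˡ-≤ u l 0 (subst₂ _≤_ (cong (_+ l) q≡u) (sym (+-identityʳ u)) q+l≤u))

overshoot : ∀ q u l → u ≤ q → q + suc (suc l) ≢ suc u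
overshoot q u l u≤q e =
  <⇒≢ (subst (_≤ q + suc (suc l)) (+-comm u 2) (+-mono-≤ u≤q (s≤s (s≤s (z≤n {l}))))) (sym e)

firing : ∀ {N c i α β rest} → Invariant N c → c i ↭ α ∷ β ∷ rest → Firing N c i rest
firing {c = c} {i = -[1+ k ]} I p = ⊥-elim (0≢1+n (trans (sym (Invariant.empty-left I k)) (PP.↭-length p)))
firing {zero} {i = + zero} I p = ⊥-elim (0≢1+n (trans (sym (Invariant.prefix-N I)) (PP.↭-length p)))
firing {suc N} {i = + zero} {rest = rest} I p =
  ⊥-elim (1+n≰n (≤-trans (s≤s (s≤s (z≤n {length rest})))
                         (≤-trans (≤-reflexive (sym (PP.↭-length p))) (Invariant.prefix-≤ I 0 (s≤s z≤n)))))
firing {N} {c} {+ suc u} {rest = rest} I p with <-cmp (suc u) N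
... | tri> _ _ N<1+u = ⊥-elim (0≢1+n (trans (sym (Invariant.empty-right I (suc u) N<1+u)) (PP.↭-length p)))
... | tri≈ _ refl _ = ⊥-elim (overshoot (prefixSize c u) u (length rest) (Invariant.prefix-≥ I u ≤-refl)
       (trans (cong (λ l → prefixSize c u + l) (sym (PP.↭-length p))) (Invariant.prefix-N I)))
... | tri< 1+u<N _ _ with squeeze (prefixSize c u) u (length rest) (Invariant.prefix-≥ I u (<-trans (n<1+n u) 1+u<N))
                        (subst (_≤ suc (suc u)) (cong (λ l → prefixSize c u + l) (PP.↭-length p)) (Invariant.prefix-≤ I (suc u) 1+u<N))
... | q≡u , l≡0 = record
  { u = u ; i≡1+u = refl ; 1+u<N = 1+u<N ; prefix-tight = q≡u
  ; two-chips = trans (PP.↭-length p) (cong (λ l → suc (suc l)) l≡0) ; rest≡[] = length≡0⇒≡[] l≡0 }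

data Around (u k : ℕ) : Set where
  below : k < u → Around u k
  at-u : k ≡ u → Around u k
  at-1+u : k ≡ suc u → Around u k
  above : ∀ d → k ≡ suc (suc u) + d → Around u k

around : ∀ u k → Around u k
around zero zero = at-u refl
around zero (suc zero) = at-1+u refl
around zero (suc (suc d)) = above d refl
around (suc u) zero = below (s≤s z≤n)
around (suc u) (suc k) with around u k
... | below k<u = below (s≤s k<u)
... | at-u e = at-u (cong suc e)
... | at-1+u e = at-1+u (cong suc e)
... | above d e = above d (cong suc e)

prefixSize-ext : ∀ {c d} k → (∀ i → i ≤ k → size c i ≡ size d i) → prefixSize c k ≡ prefixSize d k
prefixSize-ext zero e = e 0 z≤n
prefixSize-ext (suc k) e = cong₂ _+_ (prefixSize-ext k (λ i i≤k → e i (m≤n⇒m≤1+n i≤k))) (e (suc k) ≤-refl)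

prefixSize-bump : ∀ {c c'} u → (∀ k → k < u → size c' k ≡ size c k) → size c' u ≡ suc (size c u) →
                  prefixSize c' u ≡ suc (prefixSize c u)
prefixSize-bump zero lower e = e
prefixSize-bump {c} (suc w) lower e =
  trans (cong₂ _+_ (prefixSize-ext w (λ i i≤w → lower i (s≤s i≤w))) e) (+-suc (prefixSize c w) (size c (suc w)))

2+u+x≡u+2+x : ∀ u x → suc u + suc x ≡ (u + 2) + x
2+u+x≡u+2+x = solve-∀

module AfterFiring (N : ℕ) (c : Config) (u α β : ℕ) (I : Invariant N c) (p : c (+ suc u) ↭ α ∷ β ∷ [])
                   (1+u<N : suc u < N) (tight : prefixSize c u ≡ u) where
  c' : Config
  c' = topple c (+ suc u) α β []

  Far : ℕ → Set
  Far k = k ≢ u × k ≢ suc u × k ≢ suc (suc u)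

  below⇒Far : ∀ {k} → k < u → Far k
  below⇒Far k<u = <⇒≢ k<u , <⇒≢ (m<n⇒m<1+n k<u) , <⇒≢ (m<n⇒m<1+n (m<n⇒m<1+n k<u))

  above⇒Far : ∀ {k} → suc (suc u) < k → Far k
  above⇒Far lt = ≢-sym (<⇒≢ (<-trans (m<n⇒m<1+n (n<1+n u)) lt)) , ≢-sym (<⇒≢ (<-trans (n<1+n (suc u)) lt)) , ≢-sym (<⇒≢ lt)

  topple-Far : ∀ {k} → Far k → c' (+ k) ≡ c (+ k)
  topple-Far {k} (k≢u , k≢1+u , k≢2+u) = topple-far c u α β [] k k≢u k≢1+u k≢2+u

  prefix-below : ∀ k → k < u → prefixSize c' k ≡ prefixSize c k
  prefix-below k k<u = prefixSize-ext k (λ i i≤k → cong length (topple-Far (below⇒Far (≤-<-trans i≤k k<u))))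

  prefix-left : prefixSize c' u ≡ suc u
  prefix-left = trans (prefixSize-bump u (λ k k<u → cong length (topple-Far (below⇒Far k<u))) (cong length (topple-left c u α β [])))
                      (cong suc tight)

  prefix-fired : prefixSize c' (suc u) ≡ suc u
  prefix-fired = trans (cong₂ _+_ prefix-left (cong length (topple-fired c u α β []))) (+-identityʳ (suc u))

  prefix-right : prefixSize c' (suc (suc u)) ≡ prefixSize c (suc (suc u))
  prefix-right = begin
      prefixSize c' (suc u) + size c' (suc (suc u))
    ≡⟨ cong₂ _+_ prefix-fired (cong length (topple-right c u α β [])) ⟩
      suc u + suc (size c (suc (suc u)))
    ≡⟨ 2+u+x≡u+2+x u _ ⟩
      (u + 2) + size c (suc (suc u))
    ≡⟨ cong (_+ size c (suc (suc u))) (sym (cong₂ _+_ tight (PP.↭-length p))) ⟩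
      prefixSize c (suc (suc u)) ∎
    where open ≡-Reasoning

  prefix-above : ∀ d → prefixSize c' (suc (suc u) + d) ≡ prefixSize c (suc (suc u) + d)
  prefix-above zero = subst (λ k → prefixSize c' k ≡ prefixSize c k) (sym (+-identityʳ (suc (suc u)))) prefix-right
  prefix-above (suc d) = subst (λ k → prefixSize c' k ≡ prefixSize c k) (sym (+-suc (suc (suc u)) d))
    (cong₂ _+_ (prefix-above d) (cong length (topple-Far (above⇒Far (s≤s (s≤s (s≤s (m≤m+n u d))))))))

  N≡2+u+d : Σ ℕ λ d → N ≡ suc (suc u) + d
  N≡2+u+d with around u N
  ... | below N<u = ⊥-elim (<-asym N<u (<-trans (n<1+n u) 1+u<N))
  ... | at-u N≡u = ⊥-elim (<-irrefl (sym N≡u) (<-trans (n<1+n u) 1+u<N))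
  ... | at-1+u N≡1+u = ⊥-elim (<-irrefl (sym N≡1+u) 1+u<N)
  ... | above d N≡2+u+d = d , N≡2+u+d

  window-↭ : ∀ d → window (site c') 0 (u + suc (suc (suc d))) ↭ window (site c) 0 (u + suc (suc (suc d)))
  window-↭ d = begin
      window (site c') 0 (u + suc (suc (suc d)))
    ≡⟨ window-split (site c') 0 u (suc (suc (suc d))) ⟩
      window (site c') 0 u ++ window (site c') u (suc (suc (suc d)))
    ≡⟨ cong₂ _++_ low (cong₂ _++_ (topple-left c u α β [])
                       (cong₂ _++_ (topple-fired c u α β []) (cong₂ _++_ (topple-right c u α β []) high))) ⟩
      A ++ (α ∷ X) ++ [] ++ (β ∷ Z) ++ R
    ↭⟨ PP.++⁺ˡ A (↭-sym (↭-trans (PP.++⁺ˡ X (PP.++⁺ʳ (Z ++ R) p)) (PP.shift α X (β ∷ Z ++ R)))) ⟩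
      A ++ X ++ Y ++ Z ++ R
    ≡⟨ sym (window-split (site c) 0 u (suc (suc (suc d)))) ⟩
      window (site c) 0 (u + suc (suc (suc d))) ∎
    where
    open Perm.PermutationReasoning
    A = window (site c) 0 u
    X = site c u
    Y = site c (suc u)
    Z = site c (suc (suc u))
    R = window (site c) (suc (suc (suc u))) d
    low : window (site c') 0 u ≡ A
    low = window-ext u 0 (λ i _ i<u → topple-Far (below⇒Far i<u))
    high : window (site c') (suc (suc (suc u))) d ≡ R
    high = window-ext d (suc (suc (suc u))) (λ i 3+u≤i _ → topple-Far (above⇒Far 3+u≤i))

  invariant : Invariant N c'
  invariant = record
    { empty-left = Invariant.empty-left I
    ; empty-right = λ k N<k → trans (cong length (topple-Far (above⇒Far (≤-<-trans 1+u<N N<k))))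
                                     (Invariant.empty-right I k N<k)
    ; prefix-≥ = prefix-≥
    ; prefix-≤ = prefix-≤
    ; prefix-N = prefix-N
    ; window-unique = window-unique }
    where
    prefix-≥ : ∀ k → k < N → k ≤ prefixSize c' k
    prefix-≥ k k<N with around u k
    ... | below k<u = subst (k ≤_) (sym (prefix-below k k<u)) (Invariant.prefix-≥ I k k<N)
    ... | at-u refl = subst (k ≤_) (sym prefix-left) (n≤1+n k)
    ... | at-1+u refl = ≤-reflexive (sym prefix-fired)
    ... | above d refl = subst (k ≤_) (sym (prefix-above d)) (Invariant.prefix-≥ I k k<N)
    prefix-≤ : ∀ k → k < N → prefixSize c' k ≤ suc k
    prefix-≤ k k<N with around u k
    ... | below k<u = subst (_≤ suc k) (sym (prefix-below k k<u)) (Invariant.prefix-≤ I k k<N)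
    ... | at-u refl = ≤-reflexive prefix-left
    ... | at-1+u refl = subst (_≤ suc k) (sym prefix-fired) (n≤1+n k)
    ... | above d refl = subst (_≤ suc k) (sym (prefix-above d)) (Invariant.prefix-≤ I k k<N)
    prefix-N : prefixSize c' N ≡ N
    prefix-N with N≡2+u+d
    ... | d , refl = trans (prefix-above d) (Invariant.prefix-N I)
    window-unique : Unique (window (site c') 0 (suc N))
    window-unique with N≡2+u+d
    ... | d , refl = subst (λ n → Unique (window (site c') 0 n)) (sym 1+N≡)
                       (Unique-resp-↭ (↭-sym (window-↭ d)) (subst (λ n → Unique (window (site c) 0 n)) 1+N≡ (Invariant.window-unique I)))
      where
      1+N≡ : suc (suc (suc u) + d) ≡ u + suc (suc (suc d))
      1+N≡ = sym (trans (+-suc u (suc (suc d))) (cong suc (trans (+-suc u (suc d)) (cong suc (+-suc u d)))))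

Invariant-step : ∀ {N c c'} → Invariant N c → Step c c' → Invariant N c'
Invariant-step {N} {c} I (step i α β rest lt p) with firing I p
... | record { u = u ; i≡1+u = refl ; 1+u<N = 1+u<N ; prefix-tight = tight ; rest≡[] = refl } =
  AfterFiring.invariant N c u α β I p 1+u<N tight

Invariant-star : ∀ {N c c'} → Invariant N c → Star Step c c' → Invariant N c'
Invariant-star I ε = I
Invariant-star I (s ◅ ss) = Invariant-star (Invariant-step I s) ss

-- Confluence

ordered-pair-unique : ∀ {xs a b a' b'} → xs ↭ a ∷ b ∷ [] → xs ↭ a' ∷ b' ∷ [] → a < b → a' < b' → a ≡ a' × b ≡ b'
ordered-pair-unique p p' a<b a'<b' with PP.∈-resp-↭ q (here refl) | PP.∈-resp-↭ q (there (here refl))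
  where q = ↭-trans (↭-sym p) p'
... | here refl | here refl = ⊥-elim (<-irrefl refl a<b)
... | here refl | there (here refl) = refl , refl
... | there (here refl) | here refl = ⊥-elim (<-asym a<b a'<b')
... | there (here refl) | there (here refl) = ⊥-elim (<-irrefl refl a<b)

toppledSite-comm : ∀ a₁ a₂ a₃ b₁ b₂ b₃ (x : List ℕ) α β α' β' →
  (a₁ ≡ true → b₁ ≡ false × b₂ ≡ false × b₃ ≡ false) →
  (b₁ ≡ true → a₁ ≡ false × a₂ ≡ false × a₃ ≡ false) →
  (a₂ ≡ true → b₂ ≡ false) → (a₃ ≡ true → b₃ ≡ false) →
  let x₁ = toppledSite a₁ a₂ a₃ [] (α ∷ x) (β ∷ x) x
      x₂ = toppledSite b₁ b₂ b₃ [] (α' ∷ x) (β' ∷ x) x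
  in toppledSite b₁ b₂ b₃ [] (α' ∷ x₁) (β' ∷ x₁) x₁ ↭ toppledSite a₁ a₂ a₃ [] (α ∷ x₂) (β ∷ x₂) x₂
toppledSite-comm true a₂ a₃ b₁ b₂ b₃ x α β α' β' h₁ h₂ h₃ h₄ with h₁ refl
... | refl , refl , refl = ↭-refl
toppledSite-comm false a₂ a₃ true b₂ b₃ x α β α' β' h₁ h₂ h₃ h₄ with h₂ refl
... | _ , refl , refl = ↭-refl
toppledSite-comm false true a₃ false b₂ b₃ x α β α' β' h₁ h₂ h₃ h₄ with h₃ refl
toppledSite-comm false true a₃ false false true x α β α' β' h₁ h₂ h₃ h₄ | refl = ↭-swap β' α ↭-refl
toppledSite-comm false true a₃ false false false x α β α' β' h₁ h₂ h₃ h₄ | refl = ↭-refl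
toppledSite-comm false false true false b₂ b₃ x α β α' β' h₁ h₂ h₃ h₄ with h₄ refl
toppledSite-comm false false true false true false x α β α' β' h₁ h₂ h₃ h₄ | refl = ↭-swap α' β ↭-refl
toppledSite-comm false false true false false false x α β α' β' h₁ h₂ h₃ h₄ | refl = ↭-refl
toppledSite-comm false false false false b₂ b₃ x α β α' β' h₁ h₂ h₃ h₄ = ↭-refl

topple-comm : ∀ c u v α β α' β' → u ≢ v → v ≢ suc u → u ≢ suc v →
  topple (topple c (+ suc u) α β []) (+ suc v) α' β' [] ≈ topple (topple c (+ suc v) α' β' []) (+ suc u) α β []
topple-comm c u v α β α' β' u≢v v≢1+u u≢1+v -[1+ k ] = ↭-refl
topple-comm c u v α β α' β' u≢v v≢1+u u≢1+v (+ k) =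
  toppledSite-comm (k ≡ᵇ suc u) (k ≡ᵇ u) (k ≡ᵇ (suc u + 1)) (k ≡ᵇ suc v) (k ≡ᵇ v) (k ≡ᵇ (suc v + 1)) (c (+ k)) α β α' β'
    (λ e → let k≡1+u = ≡ᵇ-true⇒≡ k (suc u) e in
      ≢⇒≡ᵇ-false k (suc v) (λ e' → u≢v (suc-injective (trans (sym k≡1+u) e'))) ,
      ≢⇒≡ᵇ-false k v (λ e' → v≢1+u (trans (sym e') k≡1+u)) ,
      ≢⇒≡ᵇ-false k (suc v + 1) (λ e' → 1+≢+1 u≢1+v (trans (sym k≡1+u) e')))
    (λ e → let k≡1+v = ≡ᵇ-true⇒≡ k (suc v) e in
      ≢⇒≡ᵇ-false k (suc u) (λ e' → u≢v (suc-injective (trans (sym e') k≡1+v))) ,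
      ≢⇒≡ᵇ-false k u (λ e' → u≢1+v (trans (sym e') k≡1+v)) ,
      ≢⇒≡ᵇ-false k (suc u + 1) (λ e' → 1+≢+1 v≢1+u (trans (sym k≡1+v) e')))
    (λ e → ≢⇒≡ᵇ-false k v (λ e' → u≢v (trans (sym (≡ᵇ-true⇒≡ k u e)) e')))
    (λ e → ≢⇒≡ᵇ-false k (suc v + 1) (λ e' → u≢v (suc-injective (+-cancelʳ-≡ 1 (suc u) (suc v) (trans (sym (≡ᵇ-true⇒≡ k _ e)) e')))))
  where
  1+≢+1 : ∀ {a b} → a ≢ suc b → suc a ≢ suc b + 1
  1+≢+1 {a} {b} a≢1+b e = a≢1+b (suc-injective (trans e (+-comm (suc b) 1)))

data Joinable (c₁ c₂ : Config) : Set where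
  equivalent : c₁ ≈ c₂ → Joinable c₁ c₂
  meet : ∀ {d₁ d₂} → Step c₁ d₁ → Step c₂ d₂ → d₁ ≈ d₂ → Joinable c₁ c₂

unstable-not-adjacent : ∀ {c u v} → prefixSize c u ≡ u → size c (suc u) ≡ 2 → prefixSize c v ≡ v → v ≢ suc u
unstable-not-adjacent {c} {u} tight-u two tight-v refl =
  n≢1+n (suc u) (trans (sym tight-v) (trans (cong₂ _+_ tight-u two) (+-comm u 2)))

diamond : ∀ {N c c₁ c₂} → Invariant N c → Step c c₁ → Step c c₂ → Joinable c₁ c₂
diamond {c = c} I (step i α β _ α<β p) (step j α' β' _ α'<β' p') with firing I p | firing I p'
... | record { u = u ; i≡1+u = refl ; rest≡[] = refl ; prefix-tight = tight-u ; two-chips = two-u }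
    | record { u = v ; i≡1+u = refl ; rest≡[] = refl ; prefix-tight = tight-v ; two-chips = two-v } with u ≟ v
... | yes refl with ordered-pair-unique p p' α<β α'<β'
...   | refl , refl = equivalent ≈-refl
diamond {c = c} I (step i α β _ α<β p) (step j α' β' _ α'<β' p')
    | record { u = u ; i≡1+u = refl ; rest≡[] = refl ; prefix-tight = tight-u ; two-chips = two-u }
    | record { u = v ; i≡1+u = refl ; rest≡[] = refl ; prefix-tight = tight-v ; two-chips = two-v } | no u≢v =
  meet (step (+ suc v) α' β' [] α'<β' (subst (_↭ α' ∷ β' ∷ []) (sym v-untouched) p'))
       (step (+ suc u) α β [] α<β (subst (_↭ α ∷ β ∷ []) (sym u-untouched) p))
       (topple-comm c u v α β α' β' u≢v v≢1+u u≢1+v)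
  where
  v≢1+u : v ≢ suc u
  v≢1+u = unstable-not-adjacent tight-u two-u tight-v
  u≢1+v : u ≢ suc v
  u≢1+v = unstable-not-adjacent tight-v two-v tight-u
  v-untouched : topple c (+ suc u) α β [] (+ suc v) ≡ c (+ suc v)
  v-untouched = topple-far c u α β [] (suc v) (≢-sym u≢1+v) (u≢v ∘ sym ∘ suc-injective) (v≢1+u ∘ suc-injective)
  u-untouched : topple c (+ suc v) α' β' [] (+ suc u) ≡ c (+ suc u)
  u-untouched = topple-far c v α' β' [] (suc u) (≢-sym v≢1+u) (u≢v ∘ suc-injective) (u≢1+v ∘ suc-injective)

Stable⇒¬Step : ∀ {s s'} → Stable s → ¬ Step s s'
Stable⇒¬Step st (step i α β rest _ p) =
  1+n≰n (≤-trans (s≤s (s≤s (z≤n {length rest}))) (≤-trans (≤-reflexive (sym (PP.↭-length p))) (st i)))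

stable-after-step : ∀ {N c s c'} → Invariant N c → Star Step c s → Stable s → Step c c' →
                    Σ Config λ s' → Star Step c' s' × s ≈ s'
stable-after-step I ε st x = ⊥-elim (Stable⇒¬Step st x)
stable-after-step I (x₁ ◅ xs) st x with diamond I x₁ x
... | equivalent e = Star-resp-≈ e xs
... | meet y₁ y₂ e with stable-after-step (Invariant-step I x₁) xs st y₁
...   | s₁ , path₁ , e₁ with Star-resp-≈ e path₁
...     | s₂ , path₂ , e₂ = s₂ , y₂ ◅ path₂ , ≈-trans e₁ e₂

stable-unique : ∀ {N c s t} → Invariant N c → Star Step c s → Stable s → Star Step c t → Stable t → s ≈ t
stable-unique I ε sts ε stt = ≈-refl
stable-unique I (x ◅ ps) sts ε stt = ⊥-elim (Stable⇒¬Step stt x)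
stable-unique I ps sts (x ◅ pt) stt with stable-after-step I ps sts x
... | s' , ps' , e = ≈-trans e (stable-unique (Invariant-step I x) ps' (Stable-resp-≈ e sts) pt stt)

-- Termination

sumBelow : (ℕ → ℕ) → ℕ → ℕ
sumBelow g zero = 0
sumBelow g (suc n) = sumBelow g n + g n

-- A firing at site u+1 raises Q_u by one and lowers Q_{u+1} by one, so the weights N ∸ k
-- make the potential grow by exactly one.
potential : ℕ → Config → ℕ
potential N c = sumBelow (λ k → (N ∸ k) * prefixSize c k) N

weights-identity : ∀ s a u → s + (suc a * suc u) + (a * suc u) ≡ suc (s + (suc a * u) + (a * suc (suc u)))
weights-identity = solve-∀

module PotentialAfterFiring (N : ℕ) (c : Config) (u α β : ℕ) (I : Invariant N c) (p : c (+ suc u) ↭ α ∷ β ∷ [])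
                            (1+u<N : suc u < N) (tight : prefixSize c u ≡ u) where
  open AfterFiring N c u α β I p 1+u<N tight

  weighted : Config → ℕ → ℕ
  weighted d k = (N ∸ k) * prefixSize d k

  sum-below : ∀ n → n ≤ u → sumBelow (weighted c') n ≡ sumBelow (weighted c) n
  sum-below zero _ = refl
  sum-below (suc n) n<u = cong₂ _+_ (sum-below n (<⇒≤ n<u)) (cong ((N ∸ n) *_) (prefix-below n n<u))

  sum-through-right : sumBelow (weighted c') (suc (suc u)) ≡ suc (sumBelow (weighted c) (suc (suc u)))
  sum-through-right = begin
      (sumBelow (weighted c') u + (N ∸ u) * prefixSize c' u) + (N ∸ suc u) * prefixSize c' (suc u)
    ≡⟨ cong₂ _+_ (cong₂ _+_ (sum-below u ≤-refl) (cong₂ _*_ N∸u≡1+a prefix-left)) (cong ((N ∸ suc u) *_) prefix-fired) ⟩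
      (s + (suc a * suc u)) + (a * suc u)
    ≡⟨ weights-identity s a u ⟩
      suc ((s + (suc a * u)) + (a * suc (suc u)))
    ≡⟨ cong suc (cong₂ _+_ (cong₂ _+_ refl (cong₂ _*_ (sym N∸u≡1+a) (sym tight))) (cong (a *_) (sym prefix-1+u))) ⟩
      suc ((sumBelow (weighted c) u + (N ∸ u) * prefixSize c u) + (N ∸ suc u) * prefixSize c (suc u)) ∎
    where
    open ≡-Reasoning
    s = sumBelow (weighted c) u
    a = N ∸ suc u
    N∸u≡1+a : N ∸ u ≡ suc a
    N∸u≡1+a = +-∸-assoc 1 (<⇒≤ 1+u<N)
    prefix-1+u : prefixSize c (suc u) ≡ suc (suc u)
    prefix-1+u = trans (cong₂ _+_ tight (PP.↭-length p)) (+-comm u 2)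

  sum-above : ∀ d → sumBelow (weighted c') (suc (suc u) + d) ≡ suc (sumBelow (weighted c) (suc (suc u) + d))
  sum-above zero = subst (λ n → sumBelow (weighted c') n ≡ suc (sumBelow (weighted c) n))
                         (sym (+-identityʳ (suc (suc u)))) sum-through-right
  sum-above (suc d) = subst (λ n → sumBelow (weighted c') n ≡ suc (sumBelow (weighted c) n)) (sym (+-suc (suc (suc u)) d))
    (cong₂ _+_ (sum-above d) (cong ((N ∸ (suc (suc u) + d)) *_) (prefix-above d)))

  potential-suc : potential N c' ≡ suc (potential N c)
  potential-suc with N≡2+u+d
  ... | d , refl = sum-above d

potential-step : ∀ {N c c'} → Invariant N c → Step c c' → potential N c' ≡ suc (potential N c)
potential-step {N} {c} I (step i α β rest lt p) with firing I p
... | record { u = u ; i≡1+u = refl ; 1+u<N = 1+u<N ; prefix-tight = tight ; rest≡[] = refl } =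
  PotentialAfterFiring.potential-suc N c u α β I p 1+u<N tight

sumBelow-≤ : ∀ g M n → (∀ k → k < n → g k ≤ M) → sumBelow g n ≤ n * M
sumBelow-≤ g M zero h = z≤n
sumBelow-≤ g M (suc n) h = subst (sumBelow g n + g n ≤_) (+-comm (n * M) M)
  (+-mono-≤ (sumBelow-≤ g M n (λ k k<n → h k (m<n⇒m<1+n k<n))) (h n ≤-refl))

potential-≤ : ∀ {N c} → Invariant N c → potential N c ≤ N * (N * N)
potential-≤ {N} I = sumBelow-≤ _ (N * N) N (λ k k<N → *-mono-≤ (m∸n≤m N k) (≤-trans (Invariant.prefix-≤ I k k<N) k<N))

unstable-below? : (c : Config) (n : ℕ) → (∀ k → k < n → size c k ≤ 1) ⊎ Σ ℕ λ k → k < n × 2 ≤ size c k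
unstable-below? c zero = inj₁ (λ k ())
unstable-below? c (suc n) with unstable-below? c n
... | inj₂ (k , k<n , unstable) = inj₂ (k , m<n⇒m<1+n k<n , unstable)
... | inj₁ stable-below with size c n ≤? 1
...   | no unstable = inj₂ (n , ≤-refl , ≰⇒> unstable)
...   | yes stable-n = inj₁ λ k k<1+n → case (m≤n⇒m<n∨m≡n (≤-pred k<1+n))
  where
  case : ∀ {k} → k < n ⊎ k ≡ n → size c k ≤ 1
  case (inj₁ k<n) = stable-below _ k<n
  case (inj₂ refl) = stable-n

Unique-++⁻ʳ : ∀ (xs : List ℕ) {ys} → Unique (xs ++ ys) → Unique ys
Unique-++⁻ʳ [] u = u
Unique-++⁻ʳ (x ∷ xs) (_ ∷ u) = Unique-++⁻ʳ xs u

Unique-++⁻ˡ : ∀ (xs : List ℕ) {ys} → Unique (xs ++ ys) → Unique xs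
Unique-++⁻ˡ [] u = []
Unique-++⁻ˡ (x ∷ xs) (x∉ ∷ u) = AllP.++⁻ˡ xs x∉ ∷ Unique-++⁻ˡ xs u

site-unique : ∀ {N c} → Invariant N c → ∀ k → k ≤ N → Unique (c (+ k))
site-unique {N} {c} I k k≤N with m≤n⇒∃[o]m+o≡n k≤N
... | d , refl = Unique-++⁻ˡ (c (+ k)) (Unique-++⁻ʳ (window (site c) 0 k)
    (subst Unique (window-split (site c) 0 k (suc d))
       (subst (λ n → Unique (window (site c) 0 n)) (sym (+-suc k d)) (Invariant.window-unique I))))

stable-from-prefix : ∀ {N c} → Invariant N c → (∀ k → k < suc N → size c k ≤ 1) → Stable c
stable-from-prefix I h -[1+ k ] = subst (_≤ 1) (sym (Invariant.empty-left I k)) z≤n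
stable-from-prefix {N} I h (+ k) with k ≤? N
... | yes k≤N = h k (s≤s k≤N)
... | no k≰N = subst (_≤ 1) (sym (Invariant.empty-right I k (≰⇒> k≰N))) z≤n

Stabilises : Config → Set
Stabilises c = Σ Config λ s → Star Step c s × Stable s

stabilise-with-fuel : ∀ {N} fuel c → Invariant N c → N * (N * N) < potential N c + fuel → Stabilises c
stabilise-with-fuel {N} zero c I h =
  ⊥-elim (<-irrefl refl (<-≤-trans h (≤-trans (≤-reflexive (+-identityʳ _)) (potential-≤ I))))
stabilise-with-fuel {N} (suc fuel) c I h with unstable-below? c (suc N)
... | inj₁ stable = c , ε , stable-from-prefix I stable
... | inj₂ (k , k<1+N , unstable) = fire (c (+ k)) refl unstable (site-unique I k (≤-pred k<1+N))
  where
  continue : ∀ {c'} → Step c c' → Stabilises c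
  continue {c'} s with stabilise-with-fuel fuel c' (Invariant-step I s)
    (subst (N * (N * N) <_) (trans (+-suc (potential N c) fuel) (cong (_+ fuel) (sym (potential-step I s)))) h)
  ... | t , path , stable = t , s ◅ path , stable
  fire : ∀ xs → c (+ k) ≡ xs → 2 ≤ length xs → Unique xs → Stabilises c
  fire [] _ () _
  fire (a ∷ []) _ (s≤s ()) _
  fire (a ∷ b ∷ rest) e _ ((a≢b ∷ _) ∷ _) with <-cmp a b
  ... | tri< a<b _ _ = continue (step (+ k) a b rest a<b (↭-reflexive e))
  ... | tri≈ _ a≡b _ = ⊥-elim (a≢b a≡b)
  ... | tri> _ _ b<a = continue (step (+ k) b a rest b<a (↭-trans (↭-reflexive e) (↭-swap a b ↭-refl)))

stabilise : ∀ {N c} → Invariant N c → Stabilises c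
stabilise {N} {c} I = stabilise-with-fuel (suc (N * (N * N))) c I (m≤n+m (suc (N * (N * N))) (potential N c))

↭-short⇒≡ : ∀ {xs ys : List ℕ} → length xs ≤ 1 → xs ↭ ys → xs ≡ ys
↭-short⇒≡ {[]} _ p = sym (PP.↭-empty-inv (↭-sym p))
↭-short⇒≡ {x ∷ []} _ p = sym (PP.↭-singleton-inv (↭-sym p))
↭-short⇒≡ {x ∷ y ∷ xs} (s≤s ()) p

readConfig-resp-≈ : ∀ n {s t} → Stable s → s ≈ t → readConfig n s ≡ readConfig n t
readConfig-resp-≈ n st e = cong concat (LP.map-cong (λ i → ↭-short⇒≡ (st (+ i)) (e (+ i))) (range 0 (suc n)))

<ᵇ-view : ∀ x r → (x < r × (x <ᵇ r) ≡ true) ⊎ (r ≤ x × (x <ᵇ r) ≡ false)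
<ᵇ-view x r with x <ᵇ r in e
... | true = inj₁ (<ᵇ⇒< x r (subst B.T (sym e) tt) , refl)
... | false = inj₂ (≮⇒≥ (λ x<r → subst B.T e (<⇒<ᵇ x<r)) , refl)

shift-view : ∀ r x → (x < r × shift r x ≡ x) ⊎ (r ≤ x × shift r x ≡ suc x)
shift-view r x with <ᵇ-view x r
... | inj₁ (x<r , e) = inj₁ (x<r , cong (λ b → if b then x else suc x) e)
... | inj₂ (r≤x , e) = inj₂ (r≤x , cong (λ b → if b then x else suc x) e)

shift-injective : ∀ r {x y} → shift r x ≡ shift r y → x ≡ y
shift-injective r {x} {y} e with shift-view r x | shift-view r y
... | inj₁ (_ , ex) | inj₁ (_ , ey) = trans (sym ex) (trans e ey)
... | inj₂ (_ , ex) | inj₂ (_ , ey) = suc-injective (trans (sym ex) (trans e ey))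
... | inj₁ (x<r , ex) | inj₂ (r≤y , ey) = ⊥-elim (≤⇒≯ (≤-trans r≤y (n≤1+n y)) (subst (_< r) (trans (sym ex) (trans e ey)) x<r))
... | inj₂ (r≤x , ex) | inj₁ (y<r , ey) = ⊥-elim (≤⇒≯ (≤-trans r≤x (n≤1+n x)) (subst (_< r) (trans (sym ey) (trans (sym e) ex)) y<r))

shift-≢ : ∀ r x → shift r x ≢ r
shift-≢ r x e with shift-view r x
... | inj₁ (x<r , ex) = <-irrefl (trans (sym ex) e) x<r
... | inj₂ (r≤x , ex) = ≤⇒≯ r≤x (subst (x <_) (trans (sym ex) e) (n<1+n x))

range1-unique : ∀ m → Unique (range 1 m)
range1-unique m = UP.map⁺ suc-injective (UP.upTo⁺ (suc m ∸ 1))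

length-range1 : ∀ m → length (range 1 m) ≡ m
length-range1 m = trans (LP.length-map _ (upTo m)) (LP.length-upTo m)

IsPerm⇒Unique : ∀ {m π} → IsPerm m π → Unique π
IsPerm⇒Unique {m} p = Unique-resp-↭ (↭-sym p) (range1-unique m)

IsPerm⇒length : ∀ {m π} → IsPerm m π → length π ≡ m
IsPerm⇒length {m} p = trans (PP.↭-length p) (length-range1 m)

at-zero : ∀ π → at π 0 ≡ []
at-zero [] = refl
at-zero (x ∷ xs) = refl

at-length : ∀ π j → j < length π → length (at π (suc j)) ≡ 1
at-length (x ∷ xs) zero _ = refl
at-length (x ∷ xs) (suc j) (s≤s j<) = at-length xs j j<

at-beyond : ∀ π k → length π < k → at π k ≡ []
at-beyond [] k _ = refl
at-beyond (x ∷ xs) (suc (suc j)) (s≤s lt) = at-beyond xs (suc j) lt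

window-[] : ∀ a n → window (λ _ → []) a n ≡ []
window-[] a zero = refl
window-[] a (suc n) = window-[] (suc a) n

window-suc : ∀ {f g : ℕ → List ℕ} k n → (∀ i → k ≤ i → f (suc i) ≡ g i) → window f (suc k) n ≡ window g k n
window-suc k zero h = refl
window-suc k (suc n) h = cong₂ _++_ (h k ≤-refl) (window-suc (suc k) n (λ i le → h i (<⇒≤ le)))

window-at : ∀ π n → length π ≤ n → window (at π) 0 (suc n) ≡ π
window-at π n le = trans (cong (_++ window (at π) 1 n) (at-zero π)) (from1 π n le)
  where
  from1 : ∀ π n → length π ≤ n → window (at π) 1 n ≡ π
  from1 [] n _ = window-[] 1 n
  from1 (x ∷ xs) (suc n) (s≤s le) = cong (x ∷_) (trans (window-suc 1 n (λ { (suc i) _ → refl })) (from1 xs n le))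

window-++ : ∀ (f g : ℕ → List ℕ) a n → window (λ k → f k ++ g k) a n ↭ window f a n ++ window g a n
window-++ f g a zero = ↭-refl
window-++ f g a (suc n) = begin
    (f a ++ g a) ++ window (λ k → f k ++ g k) (suc a) n
  ↭⟨ PP.++⁺ˡ (f a ++ g a) (window-++ f g (suc a) n) ⟩
    (f a ++ g a) ++ window f (suc a) n ++ window g (suc a) n
  ≡⟨ LP.++-assoc (f a) (g a) _ ⟩
    f a ++ g a ++ window f (suc a) n ++ window g (suc a) n
  ↭⟨ PP.++⁺ˡ (f a) (PP.shifts (g a) (window f (suc a) n)) ⟩
    f a ++ window f (suc a) n ++ g a ++ window g (suc a) n
  ≡⟨ LP.++-assoc (f a) (window f (suc a) n) _ ⟨
    (f a ++ window f (suc a) n) ++ g a ++ window g (suc a) n ∎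
  where open Perm.PermutationReasoning

window-map : ∀ (h : ℕ → ℕ) f a n → window (λ k → map h (f k)) a n ≡ map h (window f a n)
window-map h f a zero = refl
window-map h f a (suc n) = trans (cong (map h (f a) ++_) (window-map h f (suc a) n)) (sym (LP.map-++ h (f a) _))

extraChip : ℕ → ℕ → ℕ → List ℕ
extraChip r p k = if k ≡ᵇ p then [ r ] else []

extraChip-≢ : ∀ r p k → k ≢ p → extraChip r p k ≡ []
extraChip-≢ r p k k≢p rewrite ≢⇒≡ᵇ-false k p k≢p = refl

extraChip-≡ : ∀ r p → extraChip r p p ≡ [ r ]
extraChip-≡ r p rewrite ≡ᵇ-refl p = refl

window-extraChip : ∀ r p d → window (extraChip r p) 0 (suc (p + d)) ≡ [ r ]
window-extraChip r p d = begin
    window (extraChip r p) 0 (suc (p + d))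
  ≡⟨ cong (window (extraChip r p) 0) (sym (+-suc p d)) ⟩
    window (extraChip r p) 0 (p + suc d)
  ≡⟨ window-split (extraChip r p) 0 p (suc d) ⟩
    window (extraChip r p) 0 p ++ extraChip r p p ++ window (extraChip r p) (suc p) d
  ≡⟨ cong₂ _++_ (trans (window-ext p 0 (λ i _ i<p → extraChip-≢ r p i (<⇒≢ i<p))) (window-[] 0 p))
                (cong₂ _++_ (extraChip-≡ r p)
                            (trans (window-ext d (suc p) (λ i p<i _ → extraChip-≢ r p i (≢-sym (<⇒≢ p<i)))) (window-[] (suc p) d))) ⟩
    [ r ] ∎
  where open ≡-Reasoning

module Initial (π : List ℕ) (m r p : ℕ) (perm : IsPerm m π) (1≤p : 1 ≤ p) (p≤m : p ≤ m) where
  private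
    c : Config
    c = initConfig π r p

    0≢p : 0 ≢ p
    0≢p = ≢-sym (m<n⇒n≢0 1≤p)

    size-at : ∀ k → size c k ≡ length (extraChip r p k) + length (at π k)
    size-at k = trans (LP.length-++ (extraChip r p k)) (cong₂ _+_ refl (LP.length-map (shift r) (at π k)))

    size-site : ∀ j → j < m → size c (suc j) ≡ length (extraChip r p (suc j)) + 1
    size-site j j<m = trans (size-at (suc j)) (cong₂ _+_ refl (at-length π j (subst (j <_) (sym (IsPerm⇒length perm)) j<m)))

    size-beyond : ∀ k → m < k → size c k ≡ 0
    size-beyond k m<k = trans (size-at k) (cong₂ _+_ (cong length (extraChip-≢ r p k (≢-sym (<⇒≢ (≤-<-trans p≤m m<k)))))
                                                   (cong length (at-beyond π k (subst (_< k) (sym (IsPerm⇒length perm)) m<k))))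

    prefix-before : ∀ k → k < p → prefixSize c k ≡ k
    prefix-before zero _ = trans (size-at 0) (cong₂ _+_ (cong length (extraChip-≢ r p 0 0≢p)) (cong length (at-zero π)))
    prefix-before (suc j) 1+j<p = trans (cong₂ _+_ (prefix-before j (<-trans (n<1+n j) 1+j<p))
                                                   (trans (size-site j (≤-trans (<⇒≤ 1+j<p) p≤m))
                                                          (cong (λ l → length l + 1) (extraChip-≢ r p (suc j) (<⇒≢ 1+j<p)))))
                                        (+-comm j 1)

    prefix-after : ∀ k → p ≤ k → k ≤ m → prefixSize c k ≡ suc k
    prefix-after zero p≤0 _ = ⊥-elim (0≢p (sym (n≤0⇒n≡0 p≤0)))
    prefix-after (suc j) p≤1+j 1+j≤m with m≤n⇒m<n∨m≡n p≤1+j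
    ... | inj₂ refl = trans (cong₂ _+_ (prefix-before j ≤-refl)
                                        (trans (size-site j 1+j≤m) (cong (λ l → length l + 1) (extraChip-≡ r (suc j)))))
                            (+-comm j 2)
    ... | inj₁ p<1+j = trans (cong₂ _+_ (prefix-after j (≤-pred p<1+j) (<⇒≤ 1+j≤m))
                                         (trans (size-site j 1+j≤m) (cong (λ l → length l + 1) (extraChip-≢ r p (suc j) (≢-sym (<⇒≢ p<1+j))))))
                             (+-comm (suc j) 1)

    prefix-squeezed : ∀ k → k ≤ m → prefixSize c k ≡ k ⊎ prefixSize c k ≡ suc k
    prefix-squeezed k k≤m with k <? p
    ... | yes k<p = inj₁ (prefix-before k k<p)
    ... | no k≮p = inj₂ (prefix-after k (≮⇒≥ k≮p) k≤m)

    window-c : window (site c) 0 (suc (suc m)) ↭ r ∷ map (shift r) π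
    window-c with m≤n⇒∃[o]m+o≡n (≤-trans p≤m (n≤1+n m))
    ... | d , p+d≡1+m = begin
        window (site c) 0 (suc (suc m))
      ↭⟨ window-++ (extraChip r p) (λ k → map (shift r) (at π k)) 0 (suc (suc m)) ⟩
        window (extraChip r p) 0 (suc (suc m)) ++ window (λ k → map (shift r) (at π k)) 0 (suc (suc m))
      ≡⟨ cong₂ _++_ (trans (cong (λ n → window (extraChip r p) 0 (suc n)) (sym p+d≡1+m)) (window-extraChip r p d))
                    (trans (window-map (shift r) (at π) 0 (suc (suc m)))
                           (cong (map (shift r)) (window-at π (suc m) (≤-trans (≤-reflexive (IsPerm⇒length perm)) (n≤1+n m))))) ⟩
        r ∷ map (shift r) π ∎
      where open Perm.PermutationReasoning

  invariant : Invariant (suc m) c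
  invariant = record
    { empty-left = λ k → refl
    ; empty-right = λ k 1+m<k → size-beyond k (<-trans (n<1+n m) 1+m<k)
    ; prefix-≥ = λ k k<1+m → [ ≤-reflexive ∘ sym , (λ e → subst (k ≤_) (sym e) (n≤1+n k)) ]′ (prefix-squeezed k (≤-pred k<1+m))
    ; prefix-≤ = λ k k<1+m → [ (λ e → ≤-trans (≤-reflexive e) (n≤1+n k)) , ≤-reflexive ]′ (prefix-squeezed k (≤-pred k<1+m))
    ; prefix-N = trans (cong₂ _+_ (prefix-after m p≤m ≤-refl) (size-beyond (suc m) ≤-refl)) (+-identityʳ (suc m))
    ; window-unique = Unique-resp-↭ (↭-sym window-c)
        (AllP.map⁺ (All.tabulate {xs = π} (λ {x} _ e → shift-≢ r x (sym e))) ∷ UP.map⁺ (shift-injective r) (IsPerm⇒Unique perm)) }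

open Initial using () renaming (invariant to initial-invariant)

Reach : Config → Config → Set
Reach c d = Σ Config λ Y → Star Step c Y × Y ≈ d

Reach-refl : ∀ {c} → Reach c c
Reach-refl = _ , ε , ≈-refl

≈⇒Reach : ∀ {c d} → c ≈ d → Reach c d
≈⇒Reach e = _ , ε , e

Reach-trans : ∀ {c d e} → Reach c d → Reach d e → Reach c e
Reach-trans (Y₁ , p₁ , e₁) (Y₂ , p₂ , e₂) with Star-resp-≈ (≈-sym e₁) p₂
... | Y₃ , p₃ , e₃ = Y₃ , p₁ ◅◅ p₃ , ≈-trans (≈-sym e₃) e₂

-- Once chip 1 has reached site 0 in π^{(1,p)}, the rest of the toppling is that of σ^{(r,p)}
-- under lift.
lift : Config → Config
lift d j = (if does (j ℤ.≟ + 0) then [ 1 ] else []) ++ map suc (d (j ℤ.- + 1))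

map-toppledSite : ∀ b1 b2 b3 r x y z → map suc (toppledSite b1 b2 b3 r x y z) ≡ toppledSite b1 b2 b3 (map suc r) (map suc x) (map suc y) (map suc z)
map-toppledSite true b2 b3 r x y z = refl
map-toppledSite false true b3 r x y z = refl
map-toppledSite false false true r x y z = refl
map-toppledSite false false false r x y z = refl

lift-topple : ∀ d u α β rest → topple (lift d) (+ suc (suc u)) (suc α) (suc β) (map suc rest) ≈ lift (topple d (+ suc u) α β rest)
lift-topple d u α β rest -[1+ k ] = ↭-refl
lift-topple d u α β rest (+ zero) = ↭-refl
lift-topple d u α β rest (+ suc k) = ↭-reflexive (sym (map-toppledSite (k ≡ᵇ suc u) (k ≡ᵇ u) (k ≡ᵇ (suc u + 1)) rest (α ∷ d (+ k)) (β ∷ d (+ k)) (d (+ k))))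

lift-Step : ∀ {N d d'} → Invariant N d → Step d d' → Reach (lift d) (lift d')
lift-Step {N} {d} I (step i α β rest lt p) with firing I p
... | record { u = u ; i≡1+u = refl } =
  _ , step (+ suc (suc u)) (suc α) (suc β) (map suc rest) (s≤s lt) (PP.map⁺ suc p) ◅ ε , lift-topple d u α β rest

lift-Star : ∀ {N d d'} → Invariant N d → Star Step d d' → Reach (lift d) (lift d')
lift-Star I ε = Reach-refl
lift-Star I (s ◅ ss) = Reach-trans (lift-Step I s) (lift-Star (Invariant-step I s) ss)

lift-negative : ∀ d k → lift d -[1+ k ] ≡ map suc (d -[1+ suc k ])
lift-negative d k = cong (λ z → map suc (d -[1+ suc z ])) (+-identityʳ k)

lift-Stable : ∀ {s} → (∀ k → length (s -[1+ k ]) ≡ 0) → Stable s → Stable (lift s)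
lift-Stable {s} I st -[1+ k ] = subst (_≤ 1) (sym (trans (cong length (lift-negative s k)) (trans (LP.length-map suc (s -[1+ suc k ])) (I (suc k))))) z≤n
lift-Stable {s} I st (+ zero) = s≤s (≤-reflexive (trans (LP.length-map suc (s -[1+ 0 ])) (I 0)))
lift-Stable {s} I st (+ suc k) = subst (_≤ 1) (sym (LP.length-map suc (s (+ k)))) (st (+ k))

-- The sweep of chip 1

lookupSite : List (List ℕ) → ℕ → List ℕ
lookupSite [] _ = []
lookupSite (x ∷ W) zero = x
lookupSite (x ∷ W) (suc k) = lookupSite W k

fromSites : List (List ℕ) → Config
fromSites W (+ k) = lookupSite W k
fromSites W -[1+ _ ] = []

addToFirst : ℕ → List (List ℕ) → List (List ℕ)
addToFirst b [] = [ [ b ] ]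
addToFirst b (z ∷ D) = (b ∷ z) ∷ D

lookupSite-mid : ∀ P (x y : List ℕ) R → lookupSite (P ++ x ∷ y ∷ R) (suc (length P)) ≡ y
lookupSite-mid [] x y R = refl
lookupSite-mid (q ∷ P) x y R = lookupSite-mid P x y R

topple-fromSites : ∀ P (x y : List ℕ) R α β rest k →
  toppledSite (k ≡ᵇ suc (length P)) (k ≡ᵇ length P) (k ≡ᵇ (suc (length P) + 1)) rest
       (α ∷ lookupSite (P ++ x ∷ y ∷ R) k) (β ∷ lookupSite (P ++ x ∷ y ∷ R) k) (lookupSite (P ++ x ∷ y ∷ R) k)
  ≡ lookupSite (P ++ (α ∷ x) ∷ rest ∷ addToFirst β R) k
topple-fromSites [] x y R α β rest zero = refl
topple-fromSites [] x y R α β rest (suc zero) = refl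
topple-fromSites [] x y [] α β rest (suc (suc zero)) = refl
topple-fromSites [] x y (z ∷ R) α β rest (suc (suc zero)) = refl
topple-fromSites [] x y [] α β rest (suc (suc (suc k))) = refl
topple-fromSites [] x y (z ∷ R) α β rest (suc (suc (suc k))) = refl
topple-fromSites (q ∷ P) x y R α β rest zero = refl
topple-fromSites (q ∷ P) x y R α β rest (suc k) = topple-fromSites P x y R α β rest k

fire-fromSites : ∀ P (x y : List ℕ) R α β rest → α < β → y ↭ α ∷ β ∷ rest →
        Reach (fromSites (P ++ x ∷ y ∷ R)) (fromSites (P ++ (α ∷ x) ∷ rest ∷ addToFirst β R))
fire-fromSites P x y R α β rest lt p =
  _ , step (+ suc (length P)) α β rest lt (subst (_↭ α ∷ β ∷ rest) (sym (lookupSite-mid P x y R)) p) ◅ ε , eq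
  where
  eq : topple (fromSites (P ++ x ∷ y ∷ R)) (+ suc (length P)) α β rest ≈ fromSites (P ++ (α ∷ x) ∷ rest ∷ addToFirst β R)
  eq -[1+ k ] = ↭-refl
  eq (+ k) = ↭-reflexive (topple-fromSites P x y R α β rest k)

-- Each firing moves chip 1 one site left and the larger chip one site right, so the singleton
-- sites end up shifted one site right.
chip1-sweep : ∀ A L (q : List ℕ) x R → All (1 <_) A → 1 < x →
       Reach (fromSites (L ++ q ∷ map [_] A ++ (1 ∷ x ∷ []) ∷ R))
             (fromSites (L ++ (1 ∷ q) ∷ [] ∷ map [_] A ++ addToFirst x R))
chip1-sweep [] L q x R _ 1<x = fire-fromSites L q (1 ∷ x ∷ []) R 1 x [] 1<x ↭-refl
chip1-sweep (a ∷ A) L q x R (1<a ∷ 1<A) 1<x =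
  Reach-trans (subst (λ W → Reach (fromSites W) (fromSites middle)) (LP.++-assoc L [ q ] _) ih)
              (subst (λ W → Reach (fromSites W) (fromSites (L ++ (1 ∷ q) ∷ [] ∷ map [_] (a ∷ A) ++ addToFirst x R)))
                     (sym (LP.++-assoc L [ q ] _))
                     (fire-fromSites L q (1 ∷ a ∷ []) ([] ∷ map [_] A ++ addToFirst x R) 1 a [] 1<a ↭-refl))
  where
  middle : List (List ℕ)
  middle = (L ++ [ q ]) ++ (1 ∷ a ∷ []) ∷ [] ∷ map [_] A ++ addToFirst x R
  ih : Reach (fromSites ((L ++ [ q ]) ++ [ a ] ∷ map [_] A ++ (1 ∷ x ∷ []) ∷ R)) (fromSites middle)
  ih = chip1-sweep A (L ++ [ q ]) [ a ] x R 1<A 1<x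

initSites : List ℕ → ℕ → ℕ → List (List ℕ)
initSites [] r p = []
initSites (x ∷ xs) r p = (extraChip r p 1 ++ [ shift r x ]) ∷ initSites xs r (p ∸ 1)

lookupSite-initSites : ∀ π r p k → p ≤ length π → lookupSite (initSites π r p) k ≡ extraChip r p (suc k) ++ map (shift r) (at π (suc k))
lookupSite-initSites [] r zero k _ = refl
lookupSite-initSites (x ∷ xs) r p zero _ = refl
lookupSite-initSites (x ∷ xs) r zero (suc k) _ = lookupSite-initSites xs r 0 k z≤n
lookupSite-initSites (x ∷ xs) r (suc p) (suc k) (s≤s le) = lookupSite-initSites xs r p k le

initConfig≈fromSites : ∀ π r p → 1 ≤ p → p ≤ length π → initConfig π r p ≈ fromSites ([] ∷ initSites π r p)
initConfig≈fromSites π r p 1≤p le -[1+ k ] = ↭-refl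
initConfig≈fromSites π r p 1≤p le (+ zero) = ↭-reflexive (cong₂ _++_ (extraChip-≢ r p 0 (≢-sym (m<n⇒n≢0 1≤p))) (cong (map (shift r)) (at-zero π)))
initConfig≈fromSites π r p 1≤p le (+ suc k) = ↭-reflexive (sym (lookupSite-initSites π r p k le))

initSites-past : ∀ B r → initSites B r 0 ≡ map (λ b → [ shift r b ]) B
initSites-past [] r = refl
initSites-past (b ∷ B) r = cong ([ shift r b ] ∷_) (initSites-past B r)

initSites-split : ∀ A x B r → initSites (A ++ x ∷ B) r (suc (length A)) ≡ map (λ a → [ shift r a ]) A ++ (r ∷ shift r x ∷ []) ∷ map (λ b → [ shift r b ]) B
initSites-split [] x B r = cong ((r ∷ shift r x ∷ []) ∷_) (initSites-past B r)
initSites-split (a ∷ A) x B r = cong ([ shift r a ] ∷_) (initSites-split A x B r)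

lift-cong : ∀ {c d} → c ≈ d → lift c ≈ lift d
lift-cong {c} {d} e j = PP.++⁺ˡ (if does (j ℤ.≟ + 0) then [ 1 ] else []) (PP.map⁺ suc (e (j ℤ.- + 1)))

lookupSite-map : ∀ V k → lookupSite (map (map suc) V) k ≡ map suc (lookupSite V k)
lookupSite-map [] k = refl
lookupSite-map (v ∷ V) zero = refl
lookupSite-map (v ∷ V) (suc k) = lookupSite-map V k

lift-fromSites : ∀ V → lift (fromSites ([] ∷ V)) ≈ fromSites ((1 ∷ []) ∷ map (map suc) ([] ∷ V))
lift-fromSites V -[1+ k ] = ↭-reflexive (lift-negative (fromSites ([] ∷ V)) k)
lift-fromSites V (+ zero) = ↭-refl
lift-fromSites V (+ suc k) = ↭-reflexive (sym (lookupSite-map ([] ∷ V) k))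

shift1 : ∀ y → 1 ≤ y → shift 1 y ≡ suc y
shift1 y 1≤y with shift-view 1 y
... | inj₁ (y<1 , _) = ⊥-elim (≤⇒≯ 1≤y y<1)
... | inj₂ (_ , e) = e

shift-positive : ∀ r y → 1 ≤ y → 1 ≤ shift r y
shift-positive r y 1≤y with shift-view r y
... | inj₁ (_ , e) = subst (1 ≤_) (sym e) 1≤y
... | inj₂ (_ , e) = subst (1 ≤_) (sym e) (s≤s z≤n)

chip1-sweeps-left : ∀ X x Y → All (1 ≤_) X → 1 ≤ x → All (1 ≤_) Y →
  Reach (initConfig (X ++ x ∷ Y) 1 (suc (length X)))
        (fromSites ([ 1 ] ∷ [] ∷ map (λ a → [ suc a ]) X ++ addToFirst (suc x) (map (λ a → [ suc a ]) Y)))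
chip1-sweeps-left X x Y X-pos x-pos Y-pos = Reach-trans (≈⇒Reach initial≈) sweep
  where
  X′ Y′ : List (List ℕ)
  X′ = map (λ a → [ suc a ]) X
  Y′ = map (λ a → [ suc a ]) Y
  p≤length : suc (length X) ≤ length (X ++ x ∷ Y)
  p≤length = subst (suc (length X) ≤_) (sym (trans (LP.length-++ X) (+-suc (length X) (length Y))))
                   (s≤s (m≤m+n (length X) (length Y)))
  singletons : ∀ {Z} → All (1 ≤_) Z → map (λ a → [ shift 1 a ]) Z ≡ map (λ a → [ suc a ]) Z
  singletons Z-pos = LP.map-cong-local (All.map (λ {a} 1≤a → cong [_] (shift1 a 1≤a)) Z-pos)
  sites≡ : initSites (X ++ x ∷ Y) 1 (suc (length X)) ≡ X′ ++ (1 ∷ suc x ∷ []) ∷ Y′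
  sites≡ = trans (initSites-split X x Y 1)
                 (cong₂ _++_ (singletons X-pos) (cong₂ _∷_ (cong (λ z → 1 ∷ z ∷ []) (shift1 x x-pos)) (singletons Y-pos)))
  initial≈ : initConfig (X ++ x ∷ Y) 1 (suc (length X)) ≈ fromSites ([] ∷ X′ ++ (1 ∷ suc x ∷ []) ∷ Y′)
  initial≈ = ≈-trans (initConfig≈fromSites (X ++ x ∷ Y) 1 (suc (length X)) (s≤s z≤n) p≤length)
                     (λ j → ↭-reflexive (cong (λ W → fromSites ([] ∷ W) j) sites≡))
  X′≡ : map [_] (map suc X) ≡ X′
  X′≡ = sym (LP.map-∘ X)
  sweep : Reach (fromSites ([] ∷ X′ ++ (1 ∷ suc x ∷ []) ∷ Y′)) (fromSites ([ 1 ] ∷ [] ∷ X′ ++ addToFirst (suc x) Y′))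
  sweep = subst₂ (λ V W → Reach (fromSites V) (fromSites W))
            (cong (λ W → [] ∷ W ++ (1 ∷ suc x ∷ []) ∷ Y′) X′≡)
            (cong (λ W → [ 1 ] ∷ [] ∷ W ++ addToFirst (suc x) Y′) X′≡)
            (chip1-sweep (map suc X) [] [] (suc x) Y′ (AllP.map⁺ (All.map s≤s X-pos)) (s≤s x-pos))

readConfig-applyUpTo : ∀ n c → readConfig n c ≡ concat (applyUpTo (λ i → c (+ i)) (suc (suc n)))
readConfig-applyUpTo n c = cong concat (trans (sym (LP.map-∘ {g = λ i → c (+ i)} {f = λ k → 0 + k} (upTo (suc (suc n))))) (LP.map-applyUpTo (λ i → i) (λ i → c (+ i)) (suc (suc n))))

readConfig-lift : ∀ {s} → (∀ k → length (s -[1+ k ]) ≡ 0) → ∀ m → readConfig (suc m) (lift s) ≡ 1 ∷ map suc (readConfig m s)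
readConfig-lift {s} empty m = begin
    readConfig (suc m) (lift s)
  ≡⟨ readConfig-applyUpTo (suc m) (lift s) ⟩
    (1 ∷ map suc (s -[1+ 0 ])) ++ concat (applyUpTo (λ i → map suc (s (+ i))) (suc (suc m)))
  ≡⟨ cong₂ (λ a b → (1 ∷ map suc a) ++ b) (length≡0⇒≡[] {s -[1+ 0 ]} (empty 0)) (cong concat (sym (LP.map-applyUpTo (λ i → s (+ i)) (map suc) (suc (suc m))))) ⟩
    1 ∷ concat (map (map suc) (applyUpTo (λ i → s (+ i)) (suc (suc m))))
  ≡⟨ cong (1 ∷_) (LP.concat-map (applyUpTo (λ i → s (+ i)) (suc (suc m)))) ⟩
    1 ∷ map suc (concat (applyUpTo (λ i → s (+ i)) (suc (suc m))))
  ≡⟨ cong (λ z → 1 ∷ map suc z) (sym (readConfig-applyUpTo m s)) ⟩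
    1 ∷ map suc (readConfig m s) ∎
  where open ≡-Reasoning

readConfig-fromSites : ∀ W n → length W ≡ suc (suc n) → readConfig n (fromSites W) ≡ concat W
readConfig-fromSites W n len = trans (readConfig-applyUpTo n (fromSites W))
  (cong concat (trans (cong (applyUpTo (lookupSite W)) (sym len)) (applyUpTo-lookupSite W)))
  where
  applyUpTo-lookupSite : ∀ W → applyUpTo (lookupSite W) (length W) ≡ W
  applyUpTo-lookupSite [] = refl
  applyUpTo-lookupSite (w ∷ W) = cong (w ∷_) (applyUpTo-lookupSite W)

Reach-lift-reading : ∀ {c s} m → Reach c (lift s) → (∀ k → length (s -[1+ k ]) ≡ 0) → Stable s →
  Σ Config λ Y → Star Step c Y × Stable Y × readConfig (suc m) Y ≡ 1 ∷ map suc (readConfig m s)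
Reach-lift-reading {s = s} m (Y , path , Y≈) empty stable =
  Y , path , stable-Y , trans (readConfig-resp-≈ (suc m) stable-Y Y≈) (readConfig-lift {s} empty m)
  where
  stable-Y : Stable Y
  stable-Y = Stable-resp-≈ (≈-sym Y≈) (lift-Stable {s} empty stable)

range1-suc : ∀ n → range 1 (suc n) ≡ 1 ∷ map suc (range 1 n)
range1-suc n = cong (1 ∷_) (cong (map suc) (sym (LP.map-applyUpTo (λ i → i) suc n)))

lifted-reading⇔ : ∀ n xs → (1 ∷ map suc xs ≡ range 1 (suc n)) ⇔ (xs ≡ range 1 n)
lifted-reading⇔ n xs = mk⇔ (λ e → LP.map-injective suc-injective (LP.∷-injectiveʳ (trans e (range1-suc n))))
                           (λ e → trans (cong (λ ys → 1 ∷ map suc ys) e) (sym (range1-suc n)))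

T⇔reading : ∀ {n r p π Y} → IsPerm n π → 1 ≤ p → p ≤ n → Star Step (initConfig π r p) Y → Stable Y →
            T n r p π ⇔ (readConfig n Y ≡ range 1 (suc n))
T⇔reading {n} {r} {p} {π} perm 1≤p p≤n path stable = mk⇔
  (λ { (_ , _ , path′ , stable′ , read≡) →
       trans (readConfig-resp-≈ n stable (stable-unique (initial-invariant π n r p perm 1≤p p≤n) path stable path′ stable′)) read≡ })
  (λ read≡ → perm , _ , path , stable , read≡)

T⇔lifted-reading : ∀ {m r p π Y xs} → IsPerm (suc m) π → 1 ≤ p → p ≤ suc m → Star Step (initConfig π r p) Y → Stable Y →
                   readConfig (suc m) Y ≡ 1 ∷ map suc xs → T (suc m) r p π ⇔ (xs ≡ range 1 (suc m))
T⇔lifted-reading {m} {xs = xs} perm 1≤p p≤ path stable read≡ =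
  ⇔.trans (T⇔reading perm 1≤p p≤ path stable)
          (subst (λ ys → (ys ≡ range 1 (suc (suc m))) ⇔ (xs ≡ range 1 (suc m))) (sym read≡) (lifted-reading⇔ (suc m) xs))

-- HasCard asks for an explicit list, so each 𝒯 is obtained by filtering all words of length m
-- over 1..m with a decision procedure for T.

_↭?_ : ∀ (xs ys : List ℕ) → Dec (xs ↭ ys)
xs ↭? ys = map′ (λ e → ↭-trans (↭-sym (sort-↭ xs)) (↭-trans (↭-reflexive e) (sort-↭ ys))) sort-resp-↭ (LP.≡-dec _≟_ (sort xs) (sort ys))
  where
  sort-resp-↭ : xs ↭ ys → sort xs ≡ sort ys
  sort-resp-↭ p = Pointwise-≡⇒≡ (↗↭↗⇒≋ ≤-totalOrder (sort-↗ xs) (sort-↗ ys) (Perm.↭⇒↭ₛ (↭-trans (sort-↭ xs) (↭-trans p (↭-sym (sort-↭ ys))))))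

T? : ∀ m r p → 1 ≤ p → p ≤ m → ∀ π → Dec (T m r p π)
T? m r p 1≤p p≤m π with π ↭? range 1 m
... | no ¬perm = no (¬perm ∘ proj₁)
... | yes perm with stabilise (initial-invariant π m r p perm 1≤p p≤m)
...   | Y , path , stable = Dec.map (⇔.sym (T⇔reading perm 1≤p p≤m path stable)) (LP.≡-dec _≟_ (readConfig m Y) (range 1 (suc m)))

words : List ℕ → ℕ → List (List ℕ)
words xs zero = [ [] ]
words xs (suc k) = cartesianProductWith _∷_ xs (words xs k)

words-unique : ∀ {xs} k → Unique xs → Unique (words xs k)
words-unique zero u = [] ∷ []
words-unique (suc k) u = UP.cartesianProductWith⁺ _∷_ LP.∷-injective u (words-unique k u)

words-complete : ∀ {xs} π → All (_∈ xs) π → π ∈ words xs (length π)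
words-complete [] [] = here refl
words-complete (x ∷ π) (x∈ ∷ π⊆) = LMP.∈-cartesianProductWith⁺ _∷_ x∈ (words-complete π π⊆)

IsPerm⇒∈words : ∀ {m π} → IsPerm m π → π ∈ words (range 1 m) m
IsPerm⇒∈words {m} {π} perm =
  subst (λ k → π ∈ words (range 1 m) k) (IsPerm⇒length perm) (words-complete π (All.tabulate (PP.∈-resp-↭ perm)))

HasCard-filter : ∀ {P : List ℕ → Set} m (P? : ∀ π → Dec (P π)) → (∀ π → P π → IsPerm m π) →
                 HasCard P (length (filter P? (words (range 1 m) m)))
HasCard-filter m P? P⇒perm = filter P? (words (range 1 m) m) , UP.filter⁺ P? (words-unique m (range1-unique m)) , refl ,
  λ π → mk⇔ (λ π∈ → proj₂ (LMP.∈-filter⁻ P? {xs = words (range 1 m) m} π∈)) (λ t → LMP.∈-filter⁺ P? (IsPerm⇒∈words (P⇒perm π t)) t)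

insertAt : ℕ → ℕ → List ℕ → List ℕ
insertAt zero x ys = x ∷ ys
insertAt (suc k) x [] = [ x ]
insertAt (suc k) x (y ∷ ys) = y ∷ insertAt k x ys

insertAt-++ : ∀ X x Y → insertAt (length X) x (X ++ Y) ≡ X ++ x ∷ Y
insertAt-++ [] x Y = refl
insertAt-++ (a ∷ X) x Y = cong (a ∷_) (insertAt-++ X x Y)

insertAt-↭ : ∀ k x ys → insertAt k x ys ↭ x ∷ ys
insertAt-↭ zero x ys = ↭-refl
insertAt-↭ (suc k) x [] = ↭-refl
insertAt-↭ (suc k) x (y ∷ ys) = ↭-trans (↭-prep y (insertAt-↭ k x ys)) (↭-swap y x ↭-refl)

insertAt-≢[] : ∀ k x ys → insertAt k x ys ≢ []
insertAt-≢[] zero x ys ()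
insertAt-≢[] (suc k) x [] ()
insertAt-≢[] (suc k) x (y ∷ ys) ()

insertAt-injectiveʳ : ∀ k x xs ys → insertAt k x xs ≡ insertAt k x ys → xs ≡ ys
insertAt-injectiveʳ zero x xs ys e = LP.∷-injectiveʳ e
insertAt-injectiveʳ (suc k) x [] [] e = refl
insertAt-injectiveʳ (suc k) x [] (y ∷ ys) e = ⊥-elim (insertAt-≢[] k x ys (sym (LP.∷-injectiveʳ e)))
insertAt-injectiveʳ (suc k) x (y ∷ xs) [] e = ⊥-elim (insertAt-≢[] k x xs (LP.∷-injectiveʳ e))
insertAt-injectiveʳ (suc k) x (y ∷ xs) (y' ∷ ys) e =
  cong₂ _∷_ (LP.∷-injectiveˡ e) (insertAt-injectiveʳ k x xs ys (LP.∷-injectiveʳ e))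

insertAt-injectiveˡ : ∀ k x x' xs ys → k ≤ length xs → length xs ≡ length ys → insertAt k x xs ≡ insertAt k x' ys → x ≡ x'
insertAt-injectiveˡ zero x x' xs ys _ _ e = LP.∷-injectiveˡ e
insertAt-injectiveˡ (suc k) x x' (a ∷ xs) (b ∷ ys) (s≤s k≤) len e =
  insertAt-injectiveˡ k x x' xs ys k≤ (suc-injective len) (LP.∷-injectiveʳ e)

split-at : ∀ (xs : List ℕ) k → k < length xs → Σ (List ℕ) λ X → Σ ℕ λ x → Σ (List ℕ) λ Y → xs ≡ X ++ x ∷ Y × length X ≡ k
split-at (x ∷ xs) zero _ = [] , x , xs , refl , refl
split-at (x ∷ xs) (suc k) (s≤s k<) with split-at xs k k<
... | X , y , Y , e , len = x ∷ X , y , Y , cong (x ∷_) e , cong suc len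

embed : ℕ → ℕ → List ℕ → List ℕ
embed r p σ = insertAt (p ∸ 1) r (map (shift r) σ)

unshift : ℕ → ℕ → ℕ
unshift r y = if y <ᵇ r then y else Data.Nat.pred y

unshift-shift : ∀ r x → unshift r (shift r x) ≡ x
unshift-shift r x with <ᵇ-view x r
... | inj₁ (_ , e) rewrite e | e = refl
... | inj₂ (r≤x , e) rewrite e with <ᵇ-view (suc x) r
...   | inj₁ (1+x<r , _) = ⊥-elim (≤⇒≯ r≤x (<-trans (n<1+n x) 1+x<r))
...   | inj₂ (_ , e') rewrite e' = refl

shift-unshift : ∀ r y → y ≢ r → shift r (unshift r y) ≡ y
shift-unshift r y y≢r with <ᵇ-view y r
... | inj₁ (_ , e) rewrite e | e = refl
shift-unshift r zero 0≢r | inj₂ (r≤0 , e) = ⊥-elim (0≢r (sym (n≤0⇒n≡0 r≤0)))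
shift-unshift r (suc y) 1+y≢r | inj₂ (r≤1+y , e) rewrite e with <ᵇ-view y r
... | inj₁ (y<r , _) = ⊥-elim (1+y≢r (≤-antisym y<r r≤1+y))
... | inj₂ (_ , e') rewrite e' = refl

range1-snoc : ∀ m → range 1 (suc m) ≡ range 1 m ++ [ suc m ]
range1-snoc m = trans (cong (map suc) (sym (LP.applyUpTo-∷ʳ (λ i → i) m))) (LP.map-++ suc (upTo m) [ m ])

∈-range1⁻ : ∀ {n x} → x ∈ range 1 n → 1 ≤ x × x ≤ n
∈-range1⁻ x∈ with LMP.∈-map⁻ (λ k → 1 + k) x∈
... | k , k∈ , refl = s≤s z≤n , LMP.∈-upTo⁻ k∈

IsPerm⇒positive : ∀ {n π} → IsPerm n π → All (1 ≤_) π
IsPerm⇒positive perm = All.tabulate (λ x∈ → proj₁ (∈-range1⁻ (PP.∈-resp-↭ perm x∈)))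

range1-↭-shift : ∀ m r → 1 ≤ r → r ≤ suc m → range 1 (suc m) ↭ r ∷ map (shift r) (range 1 m)
range1-↭-shift m r 1≤r r≤1+m with m≤n⇒m<n∨m≡n r≤1+m
... | inj₂ refl = ↭-trans (↭-reflexive (range1-snoc m))
      (↭-trans (PP.++-comm (range 1 m) [ suc m ])
      (↭-prep (suc m) (↭-reflexive (sym (LP.map-id-local (All.tabulate (λ {y} y∈ → shift-below y (proj₂ (∈-range1⁻ y∈)))))))))
  where
  shift-below : ∀ y → y ≤ m → shift (suc m) y ≡ y
  shift-below y y≤m with shift-view (suc m) y
  ... | inj₁ (_ , e) = e
  ... | inj₂ (1+m≤y , _) = ⊥-elim (≤⇒≯ 1+m≤y (s≤s y≤m))
range1-↭-shift zero r 1≤r r≤1 | inj₁ (s≤s r≤0) = ⊥-elim (≤⇒≯ 1≤r (s≤s r≤0))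
range1-↭-shift (suc m) r 1≤r r≤2+m | inj₁ (s≤s r≤1+m) = begin
    range 1 (suc (suc m))
  ≡⟨ range1-snoc (suc m) ⟩
    range 1 (suc m) ++ [ suc (suc m) ]
  ↭⟨ PP.++⁺ʳ [ suc (suc m) ] (range1-↭-shift m r 1≤r r≤1+m) ⟩
    r ∷ map (shift r) (range 1 m) ++ [ suc (suc m) ]
  ≡⟨ cong (λ z → r ∷ map (shift r) (range 1 m) ++ [ z ]) (sym shift-top) ⟩
    r ∷ map (shift r) (range 1 m) ++ [ shift r (suc m) ]
  ≡⟨ cong (r ∷_) (trans (sym (LP.map-++ (shift r) (range 1 m) [ suc m ])) (cong (map (shift r)) (sym (range1-snoc m)))) ⟩
    r ∷ map (shift r) (range 1 (suc m)) ∎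
  where
  open Perm.PermutationReasoning
  shift-top : shift r (suc m) ≡ suc (suc m)
  shift-top with shift-view r (suc m)
  ... | inj₂ (_ , e) = e
  ... | inj₁ (1+m<r , _) = ⊥-elim (≤⇒≯ r≤1+m 1+m<r)

embed-IsPerm : ∀ m r p σ → 1 ≤ r → r ≤ suc m → IsPerm m σ → IsPerm (suc m) (embed r p σ)
embed-IsPerm m r p σ 1≤r r≤ perm =
  ↭-trans (insertAt-↭ (p ∸ 1) r (map (shift r) σ)) (↭-trans (↭-prep r (PP.map⁺ (shift r) perm)) (↭-sym (range1-↭-shift m r 1≤r r≤)))

embed-surjective : ∀ m p π → p ≤ suc m → IsPerm (suc m) π →
  Σ ℕ λ r → Σ (List ℕ) λ σ → (1 ≤ r × r ≤ suc m) × IsPerm m σ × embed r p σ ≡ π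
embed-surjective m p π p≤ perm
  with split-at π (p ∸ 1) (subst (p ∸ 1 <_) (sym (IsPerm⇒length perm)) (s≤s (∸-monoˡ-≤ 1 p≤)))
... | X , r , Y , refl , len = r , σ , r∈ , σ-perm , embed≡
  where
  r∈ : 1 ≤ r × r ≤ suc m
  r∈ = ∈-range1⁻ (PP.∈-resp-↭ perm (LMP.∈-++⁺ʳ X (here refl)))
  r∉ : All (r ≢_) (X ++ Y)
  r∉ with Unique-resp-↭ (PP.shift r X Y) (IsPerm⇒Unique perm)
  ... | r∉ ∷ _ = r∉
  σ : List ℕ
  σ = map (unshift r) (X ++ Y)
  shift-σ : map (shift r) σ ≡ X ++ Y
  shift-σ = trans (sym (LP.map-∘ (X ++ Y))) (LP.map-id-local (All.map (λ r≢y → shift-unshift r _ (≢-sym r≢y)) r∉))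
  embed≡ : embed r p σ ≡ X ++ r ∷ Y
  embed≡ = trans (cong (insertAt (p ∸ 1) r) shift-σ) (trans (cong (λ k → insertAt k r (X ++ Y)) (sym len)) (insertAt-++ X r Y))
  σ-perm : IsPerm m σ
  σ-perm = ↭-trans (PP.map⁺ (unshift r) (PP.drop-∷ (↭-trans (↭-sym (PP.shift r X Y)) (↭-trans perm (range1-↭-shift m r (proj₁ r∈) (proj₂ r∈))))))
                   (↭-reflexive (trans (sym (LP.map-∘ (range 1 m))) (LP.map-id-local (All.tabulate (λ {x} _ → unshift-shift r x)))))

embed-injective : ∀ r p {σ σ'} → embed r p σ ≡ embed r p σ' → σ ≡ σ'
embed-injective r p {σ} {σ'} e =
  LP.map-injective (shift-injective r) (insertAt-injectiveʳ (p ∸ 1) r (map (shift r) σ) (map (shift r) σ') e)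

-- From π^{(1,p)} to σ^{(r,p)}

initConfig-embed-reaches-lift : ∀ r p σ → 1 ≤ p → p ≤ length σ → 1 ≤ r → All (1 ≤_) σ →
                                Reach (initConfig (embed r p σ) 1 p) (lift (initConfig σ r p))
initConfig-embed-reaches-lift r (suc p) σ _ p≤ 1≤r σ-pos with split-at σ p p≤
... | A , b , B , refl , refl = Reach-trans sweep (≈⇒Reach lifted)
  where
  X = map (shift r) A
  Y = shift r b ∷ map (shift r) B
  A-pos : All (1 ≤_) A
  A-pos = AllP.++⁻ˡ A σ-pos
  bB-pos : All (1 ≤_) (b ∷ B)
  bB-pos = AllP.++⁻ʳ A σ-pos
  X-pos : All (1 ≤_) X
  X-pos = AllP.map⁺ (All.map (shift-positive r _) A-pos)
  Y-pos : All (1 ≤_) Y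
  Y-pos = shift-positive r b (All.head bB-pos) ∷ AllP.map⁺ (All.map (shift-positive r _) (All.tail bB-pos))
  final : List (List ℕ)
  final = [ 1 ] ∷ [] ∷ map (λ a → [ suc a ]) X ++ addToFirst (suc r) (map (λ a → [ suc a ]) Y)
  embed≡ : insertAt (length A) r (map (shift r) (A ++ b ∷ B)) ≡ X ++ r ∷ Y
  embed≡ = trans (cong (insertAt (length A) r) (LP.map-++ (shift r) A (b ∷ B)))
         (trans (cong (λ k → insertAt k r (X ++ Y)) (sym (LP.length-map (shift r) A))) (insertAt-++ X r Y))
  sweep : Reach (initConfig (insertAt (length A) r (map (shift r) (A ++ b ∷ B))) 1 (suc (length A))) (fromSites final)
  sweep = subst₂ (λ π q → Reach (initConfig π 1 q) (fromSites final)) (sym embed≡) (cong suc (LP.length-map (shift r) A))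
                 (chip1-sweeps-left X r Y X-pos 1≤r Y-pos)
  map-shift-suc : ∀ L → map (λ a → [ suc a ]) (map (shift r) L) ≡ map (map suc) (map (λ a → [ shift r a ]) L)
  map-shift-suc L = trans (sym (LP.map-∘ L)) (LP.map-∘ L)
  final≡ : final ≡ [ 1 ] ∷ map (map suc) ([] ∷ initSites (A ++ b ∷ B) r (suc (length A)))
  final≡ = cong (λ z → [ 1 ] ∷ [] ∷ z)
         (trans (cong₂ (λ u v → u ++ (suc r ∷ suc (shift r b) ∷ []) ∷ v) (map-shift-suc A) (map-shift-suc B))
         (trans (sym (LP.map-++ (map suc) (map (λ a → [ shift r a ]) A) _))
                (cong (map (map suc)) (sym (initSites-split A b B r)))))
  lifted : fromSites final ≈ lift (initConfig (A ++ b ∷ B) r (suc (length A)))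
  lifted = ≈-trans (λ j → ↭-reflexive (cong (λ W → fromSites W j) final≡))
        (≈-trans (≈-sym (lift-fromSites (initSites (A ++ b ∷ B) r (suc (length A)))))
          (lift-cong (≈-sym (initConfig≈fromSites (A ++ b ∷ B) r (suc (length A)) (s≤s z≤n) p≤))))

T-embed⇔ : ∀ m r p σ → 1 ≤ p → p ≤ m → 1 ≤ r → r ≤ suc m → IsPerm m σ → T (suc m) 1 p (embed r p σ) ⇔ T m r p σ
T-embed⇔ m r p σ 1≤p p≤m 1≤r r≤ perm with stabilise (initial-invariant σ m r p perm 1≤p p≤m)
... | s , path , stable
  with Reach-lift-reading {s = s} m
         (Reach-trans (initConfig-embed-reaches-lift r p σ 1≤p (subst (p ≤_) (sym (IsPerm⇒length perm)) p≤m) 1≤r (IsPerm⇒positive perm))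
                      (lift-Star I path))
         (Invariant.empty-left (Invariant-star I path)) stable
  where I = initial-invariant σ m r p perm 1≤p p≤m
... | Y , pathY , stableY , readY =
  ⇔.trans (T⇔lifted-reading (embed-IsPerm m r p σ 1≤r r≤ perm) 1≤p (≤-trans p≤m (n≤1+n m)) pathY stableY readY)
          (⇔.sym (T⇔reading perm 1≤p p≤m path stable))

singletons-Stable : ∀ π → Stable (fromSites ([] ∷ map [_] π))
singletons-Stable π -[1+ k ] = z≤n
singletons-Stable π (+ zero) = z≤n
singletons-Stable [] (+ suc k) = z≤n
singletons-Stable (x ∷ π) (+ suc zero) = ≤-refl
singletons-Stable (x ∷ π) (+ suc (suc k)) = singletons-Stable π (+ suc k)

T-last⇔ : ∀ m π → IsPerm (suc m) π → T (suc m) 1 (suc m) π ⇔ (π ≡ range 1 (suc m))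
T-last⇔ m π perm with initLast π | IsPerm⇒length perm | IsPerm⇒positive perm
... | [] | () | _
... | X ∷ʳ′ x | len | π-pos
  with Reach-lift-reading {s = fromSites ([] ∷ map [_] (X ∷ʳ x))} m (Reach-trans sweep (≈⇒Reach lifted))
                          (λ _ → refl) (singletons-Stable (X ∷ʳ x))
  where
  1+|X|≡ : suc (length X) ≡ suc m
  1+|X|≡ = trans (sym (trans (LP.length-++ X) (+-comm (length X) 1))) len
  swept : List (List ℕ)
  swept = [ 1 ] ∷ [] ∷ map (λ a → [ suc a ]) X ++ addToFirst (suc x) []
  sweep : Reach (initConfig (X ∷ʳ x) 1 (suc m)) (fromSites swept)
  sweep = subst (λ q → Reach (initConfig (X ∷ʳ x) 1 q) (fromSites swept)) 1+|X|≡
                (chip1-sweeps-left X x [] (AllP.++⁻ˡ X π-pos) (All.head (AllP.++⁻ʳ X π-pos)) [])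
  lifted : fromSites swept ≈ lift (fromSites ([] ∷ map [_] (X ∷ʳ x)))
  lifted = ≈-trans (λ j → ↭-reflexive (cong (λ W → fromSites ([ 1 ] ∷ [] ∷ W) j)
                                         (trans (sym (LP.map-++ (λ a → [ suc a ]) X [ x ])) (LP.map-∘ (X ∷ʳ x)))))
                   (≈-sym (lift-fromSites (map [_] (X ∷ʳ x))))
... | Y , path , stable , readY =
  subst (λ π → (T (suc m) 1 (suc m) (X ∷ʳ x) ⇔ (π ≡ range 1 (suc m)))) reading-π
        (T⇔lifted-reading perm (s≤s z≤n) ≤-refl path stable readY)
  where
  reading-π : readConfig m (fromSites ([] ∷ map [_] (X ∷ʳ x))) ≡ X ∷ʳ x
  reading-π = trans (readConfig-fromSites ([] ∷ map [_] (X ∷ʳ x)) m (cong suc (trans (LP.length-map [_] (X ∷ʳ x)) len))) (LP.concat-map-[ X ∷ʳ x ])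

T-last-HasCard : ∀ n → 1 ≤ n → HasCard (T n 1 n) 1
T-last-HasCard (suc m) _ = [ range 1 (suc m) ] , [] ∷ [] , refl ,
  λ π → mk⇔ (λ { (here refl) → Equivalence.from (T-last⇔ m _ ↭-refl) refl })
             (λ t → here (Equivalence.to (T-last⇔ m π (proj₁ t)) t))

module Decomposition (m p : ℕ) (1≤p : 1 ≤ p) (p≤m : p ≤ m) where
  enumerated : ℕ → List (List ℕ)
  enumerated r = filter (T? m r p 1≤p p≤m) (words (range 1 m) m)

  count : ℕ → ℕ
  count r = length (enumerated r)

  count-HasCard : ∀ r → HasCard (T m r p) (count r)
  count-HasCard r = HasCard-filter m (T? m r p 1≤p p≤m) (λ _ → proj₁)

  ∈enumerated⇒T : ∀ {r σ} → σ ∈ enumerated r → T m r p σ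
  ∈enumerated⇒T {r} σ∈ = proj₂ (LMP.∈-filter⁻ (T? m r p 1≤p p≤m) {xs = words (range 1 m) m} σ∈)

  embedded : ℕ → List (List ℕ)
  embedded r = map (embed r p) (enumerated r)

  decomposed : List (List ℕ)
  decomposed = concat (map embedded (range 1 (suc m)))

  length-decomposed : length decomposed ≡ sumRange count 1 (suc m)
  length-decomposed = trans (length-concat (map embedded (range 1 (suc m))))
    (cong Data.Nat.ListAction.sum (trans (sym (LP.map-∘ (range 1 (suc m))))
                                         (LP.map-cong (λ r → LP.length-map (embed r p) (enumerated r)) (range 1 (suc m)))))
    where
    length-concat : ∀ (xss : List (List (List ℕ))) → length (concat xss) ≡ Data.Nat.ListAction.sum (map length xss)
    length-concat [] = refl
    length-concat (xs ∷ xss) = trans (LP.length-++ xs) (cong₂ _+_ refl (length-concat xss))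

  enumerated-unique : ∀ r → Unique (enumerated r)
  enumerated-unique r = UP.filter⁺ (T? m r p 1≤p p≤m) (words-unique m (range1-unique m))

  embedded-unique : ∀ r → Unique (embedded r)
  embedded-unique r = UP.map⁺ (embed-injective r p) (enumerated-unique r)

  length-shifted : ∀ {r σ} → σ ∈ enumerated r → length (map (shift r) σ) ≡ m
  length-shifted {r} {σ} σ∈ = trans (LP.length-map (shift r) σ) (IsPerm⇒length (proj₁ (∈enumerated⇒T σ∈)))

  embedded-disjoint : ∀ {r r'} → r ≢ r' → Disjoint (embedded r) (embedded r')
  embedded-disjoint {r} {r'} r≢r' (π∈ , π∈') =
    let σ , σ∈ , π≡ = LMP.∈-map⁻ (embed r p) π∈
        σ' , σ'∈ , π≡' = LMP.∈-map⁻ (embed r' p) π∈'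
    in r≢r' (insertAt-injectiveˡ (p ∸ 1) r r' (map (shift r) σ) (map (shift r') σ')
              (subst (p ∸ 1 ≤_) (sym (length-shifted σ∈)) (≤-trans (m∸n≤m p 1) p≤m))
              (trans (length-shifted σ∈) (sym (length-shifted σ'∈))) (trans (sym π≡) π≡'))

  decomposed-unique : Unique decomposed
  decomposed-unique = UP.concat⁺ (AllP.map⁺ (All.tabulate {xs = range 1 (suc m)} (λ {r} _ → embedded-unique r)))
                                 (APP.map⁺ (AP.map embedded-disjoint (range1-unique (suc m))))

  ∈decomposed⇔T : ∀ π → π ∈ decomposed ⇔ T (suc m) 1 p π
  ∈decomposed⇔T π = mk⇔ sound complete
    where
    sound : π ∈ decomposed → T (suc m) 1 p π
    sound π∈ =
      let _ , π∈embedded , embedded∈ = LMP.∈-concat⁻′ (map embedded (range 1 (suc m))) π∈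
          r , r∈ , ≡embedded = LMP.∈-map⁻ embedded embedded∈
          σ , σ∈ , π≡ = LMP.∈-map⁻ (embed r p) (subst (π ∈_) ≡embedded π∈embedded)
          t = ∈enumerated⇒T σ∈
          1≤r , r≤ = ∈-range1⁻ r∈
      in subst (T (suc m) 1 p) (sym π≡) (Equivalence.from (T-embed⇔ m r p σ 1≤p p≤m 1≤r r≤ (proj₁ t)) t)
    complete : T (suc m) 1 p π → π ∈ decomposed
    complete t =
      let r , σ , (1≤r , r≤) , perm , embed≡ = embed-surjective m p π (≤-trans p≤m (n≤1+n m)) (proj₁ t)
          σ∈ = LMP.∈-filter⁺ (T? m r p 1≤p p≤m) (IsPerm⇒∈words perm)
                             (Equivalence.to (T-embed⇔ m r p σ 1≤p p≤m 1≤r r≤ perm) (subst (T (suc m) 1 p) (sym embed≡) t))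
          r∈ = PP.∈-resp-↭ (↭-sym (range1-↭-shift m r 1≤r r≤)) (here refl)
      in subst (_∈ decomposed) embed≡ (LMP.∈-concat⁺′ (LMP.∈-map⁺ (embed r p) σ∈) (LMP.∈-map⁺ embedded r∈))

  HasCard-T : HasCard (T (suc m) 1 p) (sumRange count 1 (suc m))
  HasCard-T = decomposed , decomposed-unique , length-decomposed , ∈decomposed⇔T

proposition4p6 : ((n : ℕ) → 1 ≤ n → HasCard (T n 1 n) 1)
               × ((n p : ℕ) → 2 ≤ n → 1 ≤ p → p ≤ n ∸ 1 →
                   Σ (ℕ → ℕ) λ c → ((r : ℕ) → 1 ≤ r → r ≤ n → HasCard (T (n ∸ 1) r p) (c r))
                                   × HasCard (T n 1 p) (sumRange c 1 n))
proposition4p6 = T-last-HasCard , decomposition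
  where
  decomposition : (n p : ℕ) → 2 ≤ n → 1 ≤ p → p ≤ n ∸ 1 →
    Σ (ℕ → ℕ) λ c → ((r : ℕ) → 1 ≤ r → r ≤ n → HasCard (T (n ∸ 1) r p) (c r)) × HasCard (T n 1 p) (sumRange c 1 n)
  decomposition (suc m) p _ 1≤p p≤m = count , (λ r _ _ → count-HasCard r) , HasCard-T
    where open Decomposition m p 1≤p p≤m
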